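{- Let $t,r$ be positive integers, $m=tr$, $n=2m$. For $a\in\mathbb{F}_{2^r}$ and $b\in\mathbb{F}_{2^n}$ let $B_{a,b}\in\mathbb{R}^{2^n}$ be the vector indexed by $x\in\mathbb{F}_{2^n}$ with $x$-coordinate $\frac{1}{2^m}(-1)^{\mathrm{Tr}_1^m(a x^{2^m+1})+\mathrm{Tr}_1^n(bx)}$, and for $x\in\mathbb{F}_{2^n}$ let $e_x$ be the standard basis vector of $\mathbb{R}^{2^n}$ with $1$ in coordinate $x$ and $0$ elsewhere. Let \[S=\{x\in\mathbb{F}_{2^n}: \mathrm{Tr}_r^m(x^{2^m+1})=0,\ x+x^{2^m}\in\mathbb{F}_{2^r}\}.\] Then \[\sum_{a\in\mathbb{F}_{2^r}}\ \sum_{b\in\mathbb{F}_{2^m},\ \mathrm{Tr}_r^m(b)=0} B_{a,b}-\sum_{x\in S}e_x=0.\]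
   Context: For integers $k\mid \ell$ and $z\in\mathbb{F}_{2^\ell}$, the trace is $\mathrm{Tr}_k^\ell(z)=z+z^{2^k}+\cdots+z^{2^{\ell-k}}\in\mathbb{F}_{2^k}$; values of $\mathrm{Tr}_1^\ell$ lie in $\mathbb{F}_2=\{0,1\}$ and are used as exponents of $-1$. Here $\mathbb{F}_{2^r}\subseteq\mathbb{F}_{2^m}\subseteq\mathbb{F}_{2^n}$, and $x^{2^m+1}\in\mathbb{F}_{2^m}$ for $x\in\mathbb{F}_{2^n}$. Vectors in $\mathbb{R}^{2^n}$ have coordinates indexed by the elements of $\mathbb{F}_{2^n}$. -}

module Defs where

open import Level using (0ℓ)
import Data.Nat as N
open N using (ℕ; zero; suc; _^_)
open import Data.List using (List; []; _∷_; filter; length)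
open import Data.List.Membership.Propositional using (_∈_)
open import Data.List.Relation.Unary.Unique.Propositional using (Unique)
open import Data.Rational using (ℚ; 0ℚ; 1ℚ; ½) renaming (_+_ to _+ℚ_; _*_ to _*ℚ_; -_ to -ℚ_)
open import Relation.Binary.PropositionalEquality using (_≡_; _≢_)
open import Relation.Nullary using (Dec; yes; no; ¬_)
open import Relation.Nullary.Decidable using (¬?)
open import Relation.Unary using (Pred; Decidable)
open import Algebra.Structures using (IsCommutativeRing)
open import Data.Product using (∃)

record GF2^ (n : ℕ) : Set₁ where
  infixl 6 _+_
  infixl 7 _*_
  field
    F        : Set
    _+_ _*_  : F → F → F
    -_       : F → F
    0# 1#    : F
    isCommRing : IsCommutativeRing _≡_ _+_ _*_ -_ 0# 1#
    0≢1      : 0# ≢ 1#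
    inverse  : ∀ x → x ≢ 0# → ∃ λ y → x * y ≡ 1#
    _≟_      : (x y : F) → Dec (x ≡ y)
    elems    : List F
    elems-unique   : Unique elems
    elems-complete : ∀ x → x ∈ elems
    elems-card     : length elems ≡ 2 ^ n

  pow : F → ℕ → F
  pow x zero    = 1#
  pow x (suc k) = x * pow x k

  Σ< : ℕ → (ℕ → F) → F
  Σ< zero    f = 0#
  Σ< (suc d) f = Σ< d f + f d

  -- Tr_k^{k·d}(z) = z + z^{2^k} + ... + z^{2^{k(d-1)}}
  Tr : (k d : ℕ) → F → F
  Tr k d z = Σ< d (λ i → pow z (2 ^ (k N.* i)))

  InSub : ℕ → Pred F 0ℓ
  InSub k x = pow x (2 ^ k) ≡ x

  inSub? : (k : ℕ) → Decidable (InSub k)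
  inSub? k x = pow x (2 ^ k) ≟ x

  -- (-1)^s for s ∈ F_2 ⊆ F, as a rational number
  sgn : F → ℚ
  sgn s with s ≟ 0#
  ... | yes _ = 1ℚ
  ... | no  _ = -ℚ 1ℚ

-- vectors in ℝ^{2^n} (rational entries suffice) indexed by field elements
Vec𝔽 : Set → Set
Vec𝔽 A = A → ℚ

vadd : {A : Set} → Vec𝔽 A → Vec𝔽 A → Vec𝔽 A
vadd u v x = u x +ℚ v x

vsub : {A : Set} → Vec𝔽 A → Vec𝔽 A → Vec𝔽 A
vsub u v x = u x +ℚ (-ℚ (v x))

vzero : {A : Set} → Vec𝔽 A
vzero _ = 0ℚ

vsum : {A B : Set} → List B → (B → Vec𝔽 A) → Vec𝔽 A
vsum []       v = vzero
vsum (y ∷ ys) v = vadd (v y) (vsum ys v)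

inv2^ : ℕ → ℚ
inv2^ zero    = 1ℚ
inv2^ (suc k) = ½ *ℚ inv2^ k

module _ {n : ℕ} (K : GF2^ n) where
  open GF2^ K

  e : F → Vec𝔽 F
  e y x with x ≟ y
  ... | yes _ = 1ℚ
  ... | no  _ = 0ℚ

  B : (m : ℕ) → F → F → Vec𝔽 F
  B m a b x = inv2^ m *ℚ sgn (Tr 1 m (a * pow x (2 ^ m N.+ 1)) + Tr 1 n (b * x))

  InS : (t r : ℕ) → Pred F 0ℓ
  InS t r x = (Tr r t (pow x (2 ^ (t N.* r) N.+ 1)) ≡ 0#)
            Data.Product.× InSub r (x + pow x (2 ^ (t N.* r)))

  inS? : (t r : ℕ) → Decidable (InS t r)
  inS? t r x with Tr r t (pow x (2 ^ (t N.* r) N.+ 1)) ≟ 0# | inSub? r (x + pow x (2 ^ (t N.* r)))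
  ... | yes p | yes q = yes (p Data.Product., q)
  ... | no ¬p | _     = no λ z → ¬p (Data.Product.proj₁ z)
  ... | yes _ | no ¬q = no λ z → ¬q (Data.Product.proj₂ z)

  sub-elems : ℕ → List F
  sub-elems r = filter (inSub? r) elems

  b-elems : (t r : ℕ) → List F
  b-elems t r = filter (λ b → Tr r t b ≟ 0#) (filter (inSub? (t N.* r)) elems)

  S-elems : (t r : ℕ) → List F
  S-elems t r = filter (inS? t r) elems

{-# OPTIONS --safe #-}
module Submission where

-- Fix x and put N = x^(2^m+1) and y = x + x^(2^m), both in F_{2^m}.  For a ∈ F_{2^r} and b ∈ F_{2^m},
-- Tr_1^m(aN) = Tr_1^r(a Tr_r^m N) and Tr_1^n(bx) = Tr_1^m(by), so the x-coordinate of the double sum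
-- is 2^(-m) times the product of two additive character sums, over F_{2^r} and over ker Tr_r^m.
-- Such a sum is the order of the group if the character is trivial and 0 otherwise (translating by
-- an element on which the character is -1 negates the sum).  The first character is trivial iff
-- Tr_r^m N = 0, the second iff y ∈ F_{2^r}: then Tr_1^m(by) = Tr_1^r(y Tr_r^m b) = 0, and otherwise
-- some b₀ = z^(2^r) + z ∈ ker Tr_r^m has Tr_1^m(b₀y) = 1.  The orders are 2^r and 2^(m-r), so the
-- coordinate is 1 on S and 0 elsewhere.
--
-- Only |F| = 2^n is given, so characteristic 2, x^(2^n) = x, these orders and the existence of
-- elements of absolute trace 1 are derived.  The orders come from |P| ≤ |ker T| · |ker U| for
-- T z = z^(2^r) + z and U = Tr_r^m on P = F_{2^m}, where U ∘ T = 0, and from bounding both kernels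
-- by the degrees of T and U as polynomials.

open import Defs
open import Level using (0ℓ)
open import Algebra.Bundles using (CommutativeRing; CommutativeSemigroup; RawMonoid)
open import Algebra.Structures using (IsCommutativeMonoid; IsCommutativeRing)
import Algebra.Properties.Group as GroupProperties
import Algebra.Properties.Monoid.Mult as MonoidMult
import Algebra.Properties.Semiring.Mult as SemiringMult
import Algebra.Solver.Ring.NaturalCoefficients.Default as NatSolver
open import Data.Nat as ℕ using (ℕ; zero; suc; z≤n; s≤s; _^_)
import Data.Nat.Properties as ℕₚ
open import Data.Rational as ℚ using (ℚ; 0ℚ; 1ℚ; ½)
import Data.Rational.Properties as ℚₚ
open import Data.Rational.Solver using () renaming (module +-*-Solver to ℚSolver)
open import Data.List using (List; []; _∷_; map; foldr; filter; length)
open import Data.List.Properties using (map-∘; filter-all)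
open import Data.List.Membership.Propositional using (_∈_)
open import Data.List.Membership.Propositional.Properties using (∈-map⁺; ∈-map⁻; ∈-filter⁺; ∈-filter⁻)
open import Data.List.Membership.Propositional.Properties.WithK using (unique∧set⇒bag)
open import Data.List.Relation.Binary.BagAndSetEquality using (∼bag⇒↭)
open import Data.List.Relation.Binary.Permutation.Propositional using (_↭_; ↭⇒↭ₛ)
import Data.List.Relation.Binary.Permutation.Propositional.Properties as ↭
open import Data.List.Relation.Binary.Permutation.Setoid.Properties using (foldr-commMonoid)
open import Data.List.Relation.Unary.Any as Any using (here; there; any?)
import Data.List.Relation.Unary.All as All
import Data.List.Relation.Unary.AllPairs as AllPairs
open import Data.List.Relation.Unary.Unique.Propositional using (Unique)
open import Data.List.Relation.Unary.Unique.Propositional.Properties using (map⁺; filter⁺)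
open import Data.Product using (∃; _×_; _,_; proj₁; proj₂)
open import Data.Sum using (_⊎_; inj₁; inj₂)
open import Function.Base using (_∘_)
open import Function.Bundles using (mk⇔)
open import Relation.Binary.PropositionalEquality
  using (_≡_; _≢_; refl; sym; trans; cong; cong₂; subst; subst₂; module ≡-Reasoning)
open import Relation.Nullary using (Dec; yes; no; ¬_; contradiction)
open import Relation.Nullary.Decidable using (_×-dec_)
open import Relation.Unary using (Pred; Decidable; _∩_)
open import Relation.Unary.Properties using (∁?; _∩?_)

unique-↭ : ∀ {A : Set} {xs ys : List A} → Unique xs → Unique ys →
           (∀ {z} → z ∈ xs → z ∈ ys) → (∀ {z} → z ∈ ys → z ∈ xs) → xs ↭ ys
unique-↭ xs! ys! to from = ∼bag⇒↭ (unique∧set⇒bag xs! ys! (mk⇔ to from))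

module ListSum {C : Set} {_∙_ : C → C → C} {ε : C}
               (isCommutativeMonoid : IsCommutativeMonoid _≡_ _∙_ ε) where
  open IsCommutativeMonoid isCommutativeMonoid
    using (setoid; identityˡ; identityʳ; isCommutativeSemigroup)

  commutativeSemigroup : CommutativeSemigroup 0ℓ 0ℓ
  commutativeSemigroup = record { isCommutativeSemigroup = isCommutativeSemigroup }

  rawMonoid : RawMonoid 0ℓ 0ℓ
  rawMonoid = record { Carrier = C ; _≈_ = _≡_ ; _∙_ = _∙_ ; ε = ε }

  open import Algebra.Properties.CommutativeSemigroup commutativeSemigroup using (interchange)
  open import Algebra.Definitions.RawMonoid rawMonoid public using () renaming (_×_ to _·_)

  ∑ : {A : Set} → List A → (A → C) → C
  ∑ xs g = foldr _∙_ ε (map g xs)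

  when : {X : Set} → Dec X → C → C
  when (yes _) c = c
  when (no _)  _ = ε

  when-⇔ : ∀ {X Y : Set} → (X → Y) → (Y → X) → (x? : Dec X) (y? : Dec Y) → ∀ c → when x? c ≡ when y? c
  when-⇔ f g (yes _) (yes _) c = refl
  when-⇔ f g (yes x) (no ¬y) c = contradiction (f x) ¬y
  when-⇔ f g (no ¬x) (yes y) c = contradiction (g y) ¬x
  when-⇔ f g (no _)  (no _)  c = refl

  when-yes : ∀ {X : Set} → X → (x? : Dec X) → ∀ c → when x? c ≡ c
  when-yes x (yes _) c = refl
  when-yes x (no ¬x) c = contradiction x ¬x

  module _ {A : Set} where

    ∑-cong : ∀ xs {g h : A → C} → (∀ {x} → x ∈ xs → g x ≡ h x) → ∑ xs g ≡ ∑ xs h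
    ∑-cong []       eq = refl
    ∑-cong (x ∷ xs) eq = cong₂ _∙_ (eq (here refl)) (∑-cong xs (eq ∘ there))

    ∑-congˡ : ∀ xs {g h : A → C} → (∀ x → g x ≡ h x) → ∑ xs g ≡ ∑ xs h
    ∑-congˡ xs eq = ∑-cong xs (λ {x} _ → eq x)

    ∑-ε : ∀ (xs : List A) → ∑ xs (λ _ → ε) ≡ ε
    ∑-ε []       = refl
    ∑-ε (x ∷ xs) = trans (identityˡ _) (∑-ε xs)

    ∑-const : ∀ (xs : List A) c → ∑ xs (λ _ → c) ≡ length xs · c
    ∑-const []       c = refl
    ∑-const (x ∷ xs) c = cong (c ∙_) (∑-const xs c)

    ∑-distrib : ∀ xs (g h : A → C) → ∑ xs (λ x → g x ∙ h x) ≡ ∑ xs g ∙ ∑ xs h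
    ∑-distrib []       g h = sym (identityˡ ε)
    ∑-distrib (x ∷ xs) g h =
      trans (cong ((g x ∙ h x) ∙_) (∑-distrib xs g h)) (interchange _ _ _ _)

    ∑-homo : ∀ xs (f : C → C) (g : A → C) → f ε ≡ ε → (∀ a b → f (a ∙ b) ≡ f a ∙ f b) →
             ∑ xs (f ∘ g) ≡ f (∑ xs g)
    ∑-homo []       f g f-ε f-∙ = sym f-ε
    ∑-homo (x ∷ xs) f g f-ε f-∙ =
      trans (cong (f (g x) ∙_) (∑-homo xs f g f-ε f-∙)) (sym (f-∙ _ _))

    ∑-↭ : ∀ {xs ys} (g : A → C) → xs ↭ ys → ∑ xs g ≡ ∑ ys g
    ∑-↭ g p = foldr-commMonoid setoid isCommutativeMonoid (↭⇒↭ₛ (↭.map⁺ g p))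

    ∑-reindex : ∀ {xs} → Unique xs → (τ σ : A → A) →
                (∀ y → σ (τ y) ≡ y) → (∀ y → τ (σ y) ≡ y) →
                (∀ {y} → y ∈ xs → τ y ∈ xs) → (∀ {y} → y ∈ xs → σ y ∈ xs) →
                (g : A → C) → ∑ xs (g ∘ τ) ≡ ∑ xs g
    ∑-reindex {xs} xs! τ σ στ τσ τ-∈ σ-∈ g =
      trans (cong (foldr _∙_ ε) (map-∘ xs)) (∑-↭ g (unique-↭ (map⁺ τ-injective xs!) xs! to from))
      where
      τ-injective : ∀ {a b} → τ a ≡ τ b → a ≡ b
      τ-injective {a} {b} eq = trans (sym (στ a)) (trans (cong σ eq) (στ b))
      to : ∀ {z} → z ∈ map τ xs → z ∈ xs
      to z∈ with ∈-map⁻ τ z∈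
      ... | w , w∈ , refl = τ-∈ w∈
      from : ∀ {z} → z ∈ xs → z ∈ map τ xs
      from {z} z∈ = subst (_∈ map τ xs) (τσ z) (∈-map⁺ τ (σ-∈ z∈))

    ∑-when-none : ∀ xs {D : A → Set} (D? : ∀ y → Dec (D y)) c →
                  (∀ {y} → y ∈ xs → ¬ D y) → ∑ xs (λ y → when (D? y) c) ≡ ε
    ∑-when-none []       D? c none = refl
    ∑-when-none (x ∷ xs) D? c none with D? x
    ... | yes d = contradiction d (none (here refl))
    ... | no _  = trans (identityˡ _) (∑-when-none xs D? c (none ∘ there))

    ∑-when-unique : ∀ {xs} → Unique xs → ∀ {D : A → Set} (D? : ∀ y → Dec (D y)) c {w} →
                    w ∈ xs → D w → (∀ {y} → D y → y ≡ w) → ∑ xs (λ y → when (D? y) c) ≡ c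
    ∑-when-unique {x ∷ xs} (x∉ AllPairs.∷ xs!) D? c w∈ dw only with D? x
    ... | yes dx = trans (cong (c ∙_) (∑-when-none xs D? c λ y∈ dy →
                     All.lookup x∉ y∈ (trans (only dx) (sym (only dy)))))
                   (identityʳ c)
    ... | no ¬dx with w∈
    ...   | here refl = contradiction dw ¬dx
    ...   | there w∈′ = trans (identityˡ _) (∑-when-unique xs! D? c w∈′ dw only)

  ∑-swap : ∀ {A B : Set} (xs : List A) (ys : List B) (f : A → B → C) →
           ∑ xs (λ x → ∑ ys (f x)) ≡ ∑ ys (λ y → ∑ xs (λ x → f x y))
  ∑-swap []       ys f = sym (∑-ε ys)
  ∑-swap (x ∷ xs) ys f =
    trans (cong (∑ ys (f x) ∙_) (∑-swap xs ys f)) (sym (∑-distrib ys (f x) _))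

module Σℕ where
  open ListSum ℕₚ.+-0-isCommutativeMonoid public

  ∑-mono-≤ : ∀ {A : Set} (xs : List A) {f g : A → ℕ} → (∀ x → f x ℕ.≤ g x) → ∑ xs f ℕ.≤ ∑ xs g
  ∑-mono-≤ []       f≤g = z≤n
  ∑-mono-≤ (x ∷ xs) f≤g = ℕₚ.+-mono-≤ (f≤g x) (∑-mono-≤ xs f≤g)

  ∑-*ʳ : ∀ {A : Set} (xs : List A) (f : A → ℕ) c → ∑ xs (λ x → f x ℕ.* c) ≡ ∑ xs f ℕ.* c
  ∑-*ʳ xs f c = ∑-homo xs (ℕ._* c) f refl (λ a b → ℕₚ.*-distribʳ-+ c a b)

  length-filter : ∀ {A : Set} {P : Pred A 0ℓ} (P? : Decidable P) xs →
                  length (filter P? xs) ≡ ∑ xs (λ x → when (P? x) 1)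
  length-filter P? []       = refl
  length-filter P? (x ∷ xs) with P? x
  ... | yes _ = cong suc (length-filter P? xs)
  ... | no _  = length-filter P? xs

module Σℚ where
  open ListSum ℚₚ.+-0-isCommutativeMonoid public

  ∑-*ˡ : ∀ {A : Set} (xs : List A) k (f : A → ℚ) → ∑ xs (λ x → k ℚ.* f x) ≡ k ℚ.* ∑ xs f
  ∑-*ˡ xs k f = ∑-homo xs (k ℚ.*_) f (ℚₚ.*-zeroʳ k) (ℚₚ.*-distribˡ-+ k)

  ∑-neg : ∀ {A : Set} (xs : List A) (f : A → ℚ) → ∑ xs (λ x → ℚ.- f x) ≡ ℚ.- ∑ xs f
  ∑-neg xs f = ∑-homo xs ℚ.-_ f refl ℚₚ.neg-distrib-+

  ∑-*-∑ : ∀ {A B : Set} (xs : List A) (ys : List B) k (f : A → ℚ) (g : B → ℚ) →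
          ∑ xs (λ a → ∑ ys (λ b → k ℚ.* (f a ℚ.* g b))) ≡ (k ℚ.* ∑ xs f) ℚ.* ∑ ys g
  ∑-*-∑ xs ys k f g = begin
    ∑ xs (λ a → ∑ ys (λ b → k ℚ.* (f a ℚ.* g b)))
      ≡⟨ ∑-congˡ xs (λ a → trans (∑-congˡ ys (λ b → sym (ℚₚ.*-assoc k (f a) (g b))))
                                 (∑-*ˡ ys (k ℚ.* f a) g)) ⟩
    ∑ xs (λ a → (k ℚ.* f a) ℚ.* ∑ ys g)
      ≡⟨ ∑-homo xs (ℚ._* ∑ ys g) (λ a → k ℚ.* f a) (ℚₚ.*-zeroˡ (∑ ys g)) (ℚₚ.*-distribʳ-+ (∑ ys g)) ⟩
    ∑ xs (λ a → k ℚ.* f a) ℚ.* ∑ ys g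
      ≡⟨ cong (ℚ._* ∑ ys g) (∑-*ˡ xs k f) ⟩
    (k ℚ.* ∑ xs f) ℚ.* ∑ ys g
      ∎
    where open ≡-Reasoning

vsum-∑ : ∀ {A B : Set} (xs : List B) (v : B → Vec𝔽 A) x → vsum xs v x ≡ Σℚ.∑ xs (λ y → v y x)
vsum-∑ []       v x = refl
vsum-∑ (y ∷ ys) v x = cong (v y x ℚ.+_) (vsum-∑ ys v x)

filter-∩ : ∀ {A : Set} {P Q : Pred A 0ℓ} (P? : Decidable P) (Q? : Decidable Q) xs →
           filter Q? (filter P? xs) ≡ filter (P? ∩? Q?) xs
filter-∩ P? Q? []       = refl
filter-∩ P? Q? (x ∷ xs) with P? x
... | no _  = filter-∩ P? Q? xs
... | yes _ with Q? x
...   | yes _ = cong (x ∷_) (filter-∩ P? Q? xs)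
...   | no _  = filter-∩ P? Q? xs

2^-mono-< : ∀ {a b} → a ℕ.< b → 2 ^ a ℕ.< 2 ^ b
2^-mono-< = ℕₚ.^-monoʳ-< 2 (s≤s (s≤s z≤n))

*-squeeze : ∀ {a b c d} .{{_ : ℕ.NonZero c}} .{{_ : ℕ.NonZero d}} →
            a ℕ.≤ c → b ℕ.≤ d → c ℕ.* d ℕ.≤ a ℕ.* b → a ≡ c × b ≡ d
*-squeeze {a} {b} {c} {d} a≤c b≤d cd≤ab =
  ℕₚ.≤-antisym a≤c (ℕₚ.*-cancelʳ-≤ c a d (ℕₚ.≤-trans cd≤ab (ℕₚ.*-monoʳ-≤ a b≤d))) ,
  ℕₚ.≤-antisym b≤d (ℕₚ.*-cancelˡ-≤ c (ℕₚ.≤-trans cd≤ab (ℕₚ.*-monoˡ-≤ b a≤c)))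

x≡-x⇒x≡0 : ∀ {x} → x ≡ ℚ.- x → x ≡ 0ℚ
x≡-x⇒x≡0 {x} x≡-x = begin
  x                  ≡⟨ solve 1 (λ x → x := con ½ :* (x :+ x)) refl x ⟩
  ½ ℚ.* (x ℚ.+ x)    ≡⟨ cong (λ y → ½ ℚ.* (x ℚ.+ y)) x≡-x ⟩
  ½ ℚ.* (x ℚ.- x)    ≡⟨ cong (½ ℚ.*_) (ℚₚ.+-inverseʳ x) ⟩
  ½ ℚ.* 0ℚ           ≡⟨ ℚₚ.*-zeroʳ ½ ⟩
  0ℚ                 ∎
  where
  open ≡-Reasoning
  open ℚSolver using (solve; _:=_; _:+_; _:*_; con)

open SemiringMult (CommutativeRing.semiring ℚₚ.+-*-commutativeRing)
  using () renaming (×1-homo-* to ℚ-×1-homo-*)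

inv2^-+ : ∀ a b → inv2^ (a ℕ.+ b) ≡ inv2^ a ℚ.* inv2^ b
inv2^-+ zero    b = sym (ℚₚ.*-identityˡ _)
inv2^-+ (suc a) b = trans (cong (½ ℚ.*_) (inv2^-+ a b)) (sym (ℚₚ.*-assoc ½ (inv2^ a) (inv2^ b)))

inv2^-cancel : ∀ a → inv2^ a ℚ.* (2 ^ a) Σℚ.· 1ℚ ≡ 1ℚ
inv2^-cancel zero    = refl
inv2^-cancel (suc a) = begin
  (½ ℚ.* inv2^ a) ℚ.* (2 ℕ.* 2 ^ a) Σℚ.· 1ℚ      ≡⟨ cong ((½ ℚ.* inv2^ a) ℚ.*_) (ℚ-×1-homo-* 2 (2 ^ a)) ⟩
  (½ ℚ.* inv2^ a) ℚ.* (2 Σℚ.· 1ℚ ℚ.* P)         ≡⟨ solve 4 (λ h i t p → (h :* i) :* (t :* p) := (h :* t) :* (i :* p))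
                                                          refl ½ (inv2^ a) (2 Σℚ.· 1ℚ) P ⟩
  (½ ℚ.* 2 Σℚ.· 1ℚ) ℚ.* (inv2^ a ℚ.* P)         ≡⟨ cong ((½ ℚ.* 2 Σℚ.· 1ℚ) ℚ.*_) (inv2^-cancel a) ⟩
  1ℚ                                            ∎
  where
  open ≡-Reasoning
  open ℚSolver using (solve; _:=_; _:*_)
  P : ℚ
  P = (2 ^ a) Σℚ.· 1ℚ

inv2^-cancel-+ : ∀ a b → (inv2^ (a ℕ.+ b) ℚ.* (2 ^ a) Σℚ.· 1ℚ) ℚ.* (2 ^ b) Σℚ.· 1ℚ ≡ 1ℚ
inv2^-cancel-+ a b = begin
  (inv2^ (a ℕ.+ b) ℚ.* P) ℚ.* Q          ≡⟨ cong (λ h → (h ℚ.* P) ℚ.* Q) (inv2^-+ a b) ⟩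
  ((inv2^ a ℚ.* inv2^ b) ℚ.* P) ℚ.* Q    ≡⟨ solve 4 (λ i j P Q → ((i :* j) :* P) :* Q := (i :* P) :* (j :* Q))
                                                  refl (inv2^ a) (inv2^ b) P Q ⟩
  (inv2^ a ℚ.* P) ℚ.* (inv2^ b ℚ.* Q)    ≡⟨ cong₂ ℚ._*_ (inv2^-cancel a) (inv2^-cancel b) ⟩
  1ℚ                                     ∎
  where
  open ≡-Reasoning
  open ℚSolver using (solve; _:=_; _:*_)
  P Q : ℚ
  P = (2 ^ a) Σℚ.· 1ℚ
  Q = (2 ^ b) Σℚ.· 1ℚ

module FiniteField {n : ℕ} (K : GF2^ n) where
  open GF2^ K public
  open IsCommutativeRing isCommRing public
    using ( +-assoc; +-comm; +-identityˡ; +-identityʳ; -‿inverseˡ; -‿inverseʳ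
          ; *-assoc; *-comm; *-identityˡ; *-identityʳ; distribˡ; distribʳ; zeroˡ; zeroʳ
          ; +-isCommutativeMonoid; *-isCommutativeMonoid)

  commutativeRing : CommutativeRing 0ℓ 0ℓ
  commutativeRing = record { isCommutativeRing = isCommRing }

  open CommutativeRing commutativeRing using (+-group; +-monoid; semiring; commutativeSemiring)
  open GroupProperties +-group using () renaming (∙-cancelˡ to +-cancelˡ; ∙-cancelʳ to +-cancelʳ)
  open MonoidMult +-monoid using () renaming (_×_ to _·_)
  open SemiringMult semiring using (×1-homo-*)
  open NatSolver commutativeSemiring using (solve; _:=_; _:+_; _:*_; con)
  open ≡-Reasoning

  module ΣF = ListSum +-isCommutativeMonoid
  module ΠF = ListSum *-isCommutativeMonoid

  -- Characteristic 2 and the Frobenius map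

  infixr 8 _^2^_
  _^2^_ : F → ℕ → F
  x ^2^ k = pow x (2 ^ k)

  no-zero-divisors : ∀ x y → x * y ≡ 0# → x ≡ 0# ⊎ y ≡ 0#
  no-zero-divisors x y xy≡0 with x ≟ 0#
  ... | yes x≡0 = inj₁ x≡0
  ... | no x≢0 with inverse x x≢0
  ...   | x⁻¹ , xx⁻¹≡1 = inj₂ (begin
    y                ≡⟨ sym (*-identityˡ y) ⟩
    1# * y           ≡⟨ cong (_* y) (sym xx⁻¹≡1) ⟩
    (x * x⁻¹) * y    ≡⟨ solve 3 (λ x x⁻¹ y → (x :* x⁻¹) :* y := x⁻¹ :* (x :* y)) refl x x⁻¹ y ⟩
    x⁻¹ * (x * y)    ≡⟨ cong (x⁻¹ *_) xy≡0 ⟩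
    x⁻¹ * 0#         ≡⟨ zeroʳ x⁻¹ ⟩
    0#               ∎)

  *-≢0 : ∀ {x y} → x ≢ 0# → y ≢ 0# → x * y ≢ 0#
  *-≢0 {x} {y} x≢0 y≢0 xy≡0 with no-zero-divisors x y xy≡0
  ... | inj₁ x≡0 = x≢0 x≡0
  ... | inj₂ y≡0 = y≢0 y≡0

  *-cancelʳ-≢0 : ∀ {p} → p ≢ 0# → ∀ x y → x * p ≡ y * p → x ≡ y
  *-cancelʳ-≢0 {p} p≢0 x y eq with inverse p p≢0
  ... | p⁻¹ , pp⁻¹≡1 = begin
    x                ≡⟨ sym (*-identityʳ x) ⟩
    x * 1#           ≡⟨ cong (x *_) (sym pp⁻¹≡1) ⟩
    x * (p * p⁻¹)    ≡⟨ sym (*-assoc x p p⁻¹) ⟩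
    (x * p) * p⁻¹    ≡⟨ cong (_* p⁻¹) eq ⟩
    (y * p) * p⁻¹    ≡⟨ *-assoc y p p⁻¹ ⟩
    y * (p * p⁻¹)    ≡⟨ cong (y *_) pp⁻¹≡1 ⟩
    y * 1#           ≡⟨ *-identityʳ y ⟩
    y                ∎

  pow-+ : ∀ x a b → pow x (a ℕ.+ b) ≡ pow x a * pow x b
  pow-+ x zero    b = sym (*-identityˡ _)
  pow-+ x (suc a) b = trans (cong (x *_) (pow-+ x a b)) (sym (*-assoc _ _ _))

  pow-distrib-* : ∀ x y a → pow (x * y) a ≡ pow x a * pow y a
  pow-distrib-* x y zero    = sym (*-identityˡ 1#)
  pow-distrib-* x y (suc a) = trans (cong ((x * y) *_) (pow-distrib-* x y a))
    (solve 4 (λ x y p q → (x :* y) :* (p :* q) := (x :* p) :* (y :* q)) refl x y (pow x a) (pow y a))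

  pow-1# : ∀ a → pow 1# a ≡ 1#
  pow-1# zero    = refl
  pow-1# (suc a) = trans (*-identityˡ _) (pow-1# a)

  pow-* : ∀ x a b → pow x (a ℕ.* b) ≡ pow (pow x a) b
  pow-* x zero    b = sym (pow-1# b)
  pow-* x (suc a) b = begin
    pow x (b ℕ.+ a ℕ.* b)       ≡⟨ pow-+ x b (a ℕ.* b) ⟩
    pow x b * pow x (a ℕ.* b)   ≡⟨ cong (pow x b *_) (pow-* x a b) ⟩
    pow x b * pow (pow x a) b   ≡⟨ sym (pow-distrib-* x (pow x a) b) ⟩
    pow (x * pow x a) b         ∎

  pow≡0⇒≡0 : ∀ x k → pow x k ≡ 0# → x ≡ 0#
  pow≡0⇒≡0 x zero    1≡0 = contradiction (sym 1≡0) 0≢1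
  pow≡0⇒≡0 x (suc k) eq with no-zero-divisors x (pow x k) eq
  ... | inj₁ x≡0 = x≡0
  ... | inj₂ p≡0 = pow≡0⇒≡0 x k p≡0

  ×1-homo-^ : ∀ a k → (a ^ k) · 1# ≡ pow (a · 1#) k
  ×1-homo-^ a zero    = +-identityʳ 1#
  ×1-homo-^ a (suc k) = trans (×1-homo-* a (a ^ k)) (cong ((a · 1#) *_) (×1-homo-^ a k))

  -- Translation by 1 permutes F, so |F| · 1 = 0; as |F| = 2^n this forces 2 · 1 = 0.
  1+1≡0 : 1# + 1# ≡ 0#
  1+1≡0 = trans (cong (1# +_) (sym (+-identityʳ 1#)))
                (pow≡0⇒≡0 (2 · 1#) n (trans (sym (×1-homo-^ 2 n)) |F|×1≡0))
    where
    ∑F : F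
    ∑F = ΣF.∑ elems (λ y → y)
    translate : ΣF.∑ elems (λ y → y + 1#) ≡ ∑F
    translate = ΣF.∑-reindex elems-unique (_+ 1#) (_+ - 1#)
      (λ y → trans (+-assoc y 1# (- 1#)) (trans (cong (y +_) (-‿inverseʳ 1#)) (+-identityʳ y)))
      (λ y → trans (+-assoc y (- 1#) 1#) (trans (cong (y +_) (-‿inverseˡ 1#)) (+-identityʳ y)))
      (λ _ → elems-complete _) (λ _ → elems-complete _) (λ y → y)
    |F|×1≡0 : (2 ^ n) · 1# ≡ 0#
    |F|×1≡0 = +-cancelˡ ∑F _ _ (begin
      ∑F + (2 ^ n) · 1#               ≡⟨ cong (λ k → ∑F + k · 1#) (sym elems-card) ⟩
      ∑F + length elems · 1#          ≡⟨ cong (∑F +_) (sym (ΣF.∑-const elems 1#)) ⟩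
      ∑F + ΣF.∑ elems (λ _ → 1#)      ≡⟨ sym (ΣF.∑-distrib elems (λ y → y) (λ _ → 1#)) ⟩
      ΣF.∑ elems (λ y → y + 1#)       ≡⟨ translate ⟩
      ∑F                              ≡⟨ sym (+-identityʳ ∑F) ⟩
      ∑F + 0#                         ∎)

  x+x≡0 : ∀ x → x + x ≡ 0#
  x+x≡0 x = begin
    x + x              ≡⟨ solve 1 (λ x → x :+ x := x :* (con 1 :+ con 1)) refl x ⟩
    x * (1# + 1#)      ≡⟨ cong (x *_) 1+1≡0 ⟩
    x * 0#             ≡⟨ zeroʳ x ⟩
    0#                 ∎

  x+y≡0⇒x≡y : ∀ {x y} → x + y ≡ 0# → x ≡ y
  x+y≡0⇒x≡y {x} {y} eq = begin
    x                ≡⟨ sym (+-identityʳ x) ⟩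
    x + 0#           ≡⟨ cong (x +_) (sym (x+x≡0 y)) ⟩
    x + (y + y)      ≡⟨ sym (+-assoc x y y) ⟩
    (x + y) + y      ≡⟨ cong (_+ y) eq ⟩
    0# + y           ≡⟨ +-identityˡ y ⟩
    y                ∎

  x+y+y≡x : ∀ x y → (x + y) + y ≡ x
  x+y+y≡x x y = trans (+-assoc x y y) (trans (cong (x +_) (x+x≡0 y)) (+-identityʳ x))

  x≡y⇒x+y≡0 : ∀ {x y} → x ≡ y → x + y ≡ 0#
  x≡y⇒x+y≡0 {x} refl = x+x≡0 x

  +-swap-sides : ∀ a b c d → a + b ≡ c + d → b + c ≡ d + a
  +-swap-sides a b c d eq = x+y≡0⇒x≡y (begin
    (b + c) + (d + a)   ≡⟨ solve 4 (λ a b c d → (b :+ c) :+ (d :+ a) := (a :+ b) :+ (c :+ d)) refl a b c d ⟩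
    (a + b) + (c + d)   ≡⟨ x≡y⇒x+y≡0 eq ⟩
    0#                  ∎)

  -- Lagrange's theorem in the multiplicative group: x ↦ x * y permutes F \ {0}.
  private module Units where
    units : List F
    units = filter (∁? (_≟ 0#)) elems

    units! : Unique units
    units! = filter⁺ (∁? (_≟ 0#)) elems-unique

    ∈units : ∀ {x} → x ≢ 0# → x ∈ units
    ∈units {x} x≢0 = ∈-filter⁺ (∁? (_≟ 0#)) (elems-complete x) x≢0

    ∈units⇒≢0 : ∀ {x} → x ∈ units → x ≢ 0#
    ∈units⇒≢0 x∈ = proj₂ (∈-filter⁻ (∁? (_≟ 0#)) {xs = elems} x∈)

    |F|≡1+|units| : 2 ^ n ≡ suc (length units)
    |F|≡1+|units| = trans (sym elems-card) (↭.↭-length (unique-↭ elems-unique 0∷units! to (λ _ → elems-complete _)))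
      where
      0∷units! : Unique (0# ∷ units)
      0∷units! = All.tabulate (λ x∈ 0≡x → ∈units⇒≢0 x∈ (sym 0≡x)) AllPairs.∷ units!
      to : ∀ {z} → z ∈ elems → z ∈ 0# ∷ units
      to {z} _ with z ≟ 0#
      ... | yes refl = here refl
      ... | no z≢0   = there (∈units z≢0)

    ∏units≢0 : ΠF.∑ units (λ y → y) ≢ 0#
    ∏units≢0 = ∏≢0 units ∈units⇒≢0
      where
      ∏≢0 : ∀ xs → (∀ {y} → y ∈ xs → y ≢ 0#) → ΠF.∑ xs (λ y → y) ≢ 0#
      ∏≢0 []       _   = λ 1≡0 → 0≢1 (sym 1≡0)
      ∏≢0 (x ∷ xs) ≢0s = *-≢0 (≢0s (here refl)) (∏≢0 xs (≢0s ∘ there))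

    pow≡· : ∀ x k → pow x k ≡ k ΠF.· x
    pow≡· x zero    = refl
    pow≡· x (suc k) = cong (x *_) (pow≡· x k)

    pow-|units| : ∀ {x} → x ≢ 0# → pow x (length units) ≡ 1#
    pow-|units| {x} x≢0 with inverse x x≢0
    ... | x⁻¹ , xx⁻¹≡1 = *-cancelʳ-≢0 ∏units≢0 _ _ (begin
      pow x (length units) * ∏              ≡⟨ cong (_* ∏) (pow≡· x (length units)) ⟩
      length units ΠF.· x * ∏               ≡⟨ cong (_* ∏) (sym (ΠF.∑-const units x)) ⟩
      ΠF.∑ units (λ _ → x) * ∏              ≡⟨ sym (ΠF.∑-distrib units (λ _ → x) (λ y → y)) ⟩
      ΠF.∑ units (λ y → x * y)              ≡⟨ ΠF.∑-reindex units! (x *_) (x⁻¹ *_) cancel cancel′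
                                                 (∈units ∘ *-≢0 x≢0 ∘ ∈units⇒≢0)
                                                 (∈units ∘ *-≢0 x⁻¹≢0 ∘ ∈units⇒≢0) (λ y → y) ⟩
      ∏                                     ≡⟨ sym (*-identityˡ ∏) ⟩
      1# * ∏                                ∎)
      where
      ∏ : F
      ∏ = ΠF.∑ units (λ y → y)
      x⁻¹x≡1 : x⁻¹ * x ≡ 1#
      x⁻¹x≡1 = trans (*-comm x⁻¹ x) xx⁻¹≡1
      x⁻¹≢0 : x⁻¹ ≢ 0#
      x⁻¹≢0 x⁻¹≡0 = 0≢1 (trans (sym (zeroˡ x)) (trans (cong (_* x) (sym x⁻¹≡0)) x⁻¹x≡1))
      cancel : ∀ y → x⁻¹ * (x * y) ≡ y
      cancel y = trans (sym (*-assoc x⁻¹ x y)) (trans (cong (_* y) x⁻¹x≡1) (*-identityˡ y))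
      cancel′ : ∀ y → x * (x⁻¹ * y) ≡ y
      cancel′ y = trans (sym (*-assoc x x⁻¹ y)) (trans (cong (_* y) xx⁻¹≡1) (*-identityˡ y))

  open Units using (units; |F|≡1+|units|; pow-|units|)

  x^2^n≡x : ∀ x → x ^2^ n ≡ x
  x^2^n≡x x with x ≟ 0#
  ... | yes refl = subst (λ k → pow 0# k ≡ 0#) (sym |F|≡1+|units|) (zeroˡ _)
  ... | no x≢0   = begin
    pow x (2 ^ n)              ≡⟨ cong (pow x) |F|≡1+|units| ⟩
    x * pow x (length units)   ≡⟨ cong (x *_) (pow-|units| x≢0) ⟩
    x * 1#                     ≡⟨ *-identityʳ x ⟩
    x                          ∎

  ^2^-suc : ∀ x k → x ^2^ suc k ≡ x ^2^ k * x ^2^ k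
  ^2^-suc x k = trans (cong (pow x) (cong (2 ^ k ℕ.+_) (ℕₚ.+-identityʳ (2 ^ k)))) (pow-+ x (2 ^ k) (2 ^ k))

  ^2^-^2^ : ∀ x a b → (x ^2^ a) ^2^ b ≡ x ^2^ (a ℕ.+ b)
  ^2^-^2^ x a b = trans (sym (pow-* x (2 ^ a) (2 ^ b))) (cong (pow x) (sym (ℕₚ.^-distribˡ-+-* 2 a b)))

  ^2^-* : ∀ x y k → (x * y) ^2^ k ≡ x ^2^ k * y ^2^ k
  ^2^-* x y k = pow-distrib-* x y (2 ^ k)

  0^2^ : ∀ k → 0# ^2^ k ≡ 0#
  0^2^ zero    = zeroˡ 1#
  0^2^ (suc k) = trans (^2^-suc 0# k) (trans (cong (_* 0# ^2^ k) (0^2^ k)) (zeroˡ _))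

  ^2^-+ : ∀ x y k → (x + y) ^2^ k ≡ x ^2^ k + y ^2^ k
  ^2^-+ x y zero    = trans (*-identityʳ (x + y)) (sym (cong₂ _+_ (*-identityʳ x) (*-identityʳ y)))
  ^2^-+ x y (suc k) = begin
    (x + y) ^2^ suc k                       ≡⟨ ^2^-suc (x + y) k ⟩
    (x + y) ^2^ k * (x + y) ^2^ k           ≡⟨ cong₂ _*_ (^2^-+ x y k) (^2^-+ x y k) ⟩
    (X + Y) * (X + Y)                       ≡⟨ solve 2 (λ X Y → (X :+ Y) :* (X :+ Y) :=
                                                 (X :* X :+ Y :* Y) :+ (X :* Y :+ X :* Y)) refl X Y ⟩
    (X * X + Y * Y) + (X * Y + X * Y)       ≡⟨ cong ((X * X + Y * Y) +_) (x+x≡0 (X * Y)) ⟩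
    (X * X + Y * Y) + 0#                    ≡⟨ +-identityʳ _ ⟩
    X * X + Y * Y                           ≡⟨ sym (cong₂ _+_ (^2^-suc x k) (^2^-suc y k)) ⟩
    x ^2^ suc k + y ^2^ suc k               ∎
    where
    X Y : F
    X = x ^2^ k
    Y = y ^2^ k

  InSub-+ : ∀ {k x y} → InSub k x → InSub k y → InSub k (x + y)
  InSub-+ {k} {x} {y} x∈ y∈ = trans (^2^-+ x y k) (cong₂ _+_ x∈ y∈)

  InSub-* : ∀ {k x y} → InSub k x → InSub k y → InSub k (x * y)
  InSub-* {k} {x} {y} x∈ y∈ = trans (^2^-* x y k) (cong₂ _*_ x∈ y∈)

  InSub-^2^ : ∀ {k x} → InSub k x → ∀ j → InSub k (x ^2^ j)
  InSub-^2^ {k} {x} x∈ j = begin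
    (x ^2^ j) ^2^ k     ≡⟨ ^2^-^2^ x j k ⟩
    x ^2^ (j ℕ.+ k)     ≡⟨ cong (x ^2^_) (ℕₚ.+-comm j k) ⟩
    x ^2^ (k ℕ.+ j)     ≡⟨ sym (^2^-^2^ x k j) ⟩
    (x ^2^ k) ^2^ j     ≡⟨ cong (_^2^ j) x∈ ⟩
    x ^2^ j             ∎

  ^2^-k*0 : ∀ k z → z ^2^ (k ℕ.* 0) ≡ z
  ^2^-k*0 k z = trans (cong (z ^2^_) (ℕₚ.*-zeroʳ k)) (*-identityʳ z)

  InSub-multipleʳ : ∀ {k x} → InSub k x → ∀ i → InSub (k ℕ.* i) x
  InSub-multipleʳ {k} {x} x∈ zero    = ^2^-k*0 k x
  InSub-multipleʳ {k} {x} x∈ (suc i) = begin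
    x ^2^ (k ℕ.* suc i)      ≡⟨ cong (x ^2^_) (ℕₚ.*-suc k i) ⟩
    x ^2^ (k ℕ.+ k ℕ.* i)    ≡⟨ sym (^2^-^2^ x k (k ℕ.* i)) ⟩
    (x ^2^ k) ^2^ (k ℕ.* i)  ≡⟨ cong (_^2^ (k ℕ.* i)) x∈ ⟩
    x ^2^ (k ℕ.* i)          ≡⟨ InSub-multipleʳ {k} x∈ i ⟩
    x                        ∎

  InSub-⁻¹ : ∀ {k x y} → InSub k x → x * y ≡ 1# → InSub k y
  InSub-⁻¹ {k} {x} {y} x∈ xy≡1 = begin
    y ^2^ k                    ≡⟨ sym (*-identityʳ _) ⟩
    y ^2^ k * 1#               ≡⟨ cong (y ^2^ k *_) (sym xy≡1) ⟩
    y ^2^ k * (x * y)          ≡⟨ cong (λ w → y ^2^ k * (w * y)) (sym x∈) ⟩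
    y ^2^ k * (x ^2^ k * y)    ≡⟨ sym (*-assoc _ _ y) ⟩
    (y ^2^ k * x ^2^ k) * y    ≡⟨ cong (_* y) (sym (^2^-* y x k)) ⟩
    (y * x) ^2^ k * y          ≡⟨ cong (λ w → w ^2^ k * y) (trans (*-comm y x) xy≡1) ⟩
    1# ^2^ k * y               ≡⟨ cong (_* y) (pow-1# (2 ^ k)) ⟩
    1# * y                     ≡⟨ *-identityˡ y ⟩
    y                          ∎

  InSub-multipleˡ : ∀ {k x} → InSub k x → ∀ d → InSub (d ℕ.* k) x
  InSub-multipleˡ {k} {x} x∈ d = subst (λ e → InSub e x) (ℕₚ.*-comm k d) (InSub-multipleʳ {k} x∈ d)

  -- Traces

  Σ<-cong : ∀ d {f g : ℕ → F} → (∀ i → f i ≡ g i) → Σ< d f ≡ Σ< d g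
  Σ<-cong zero    eq = refl
  Σ<-cong (suc d) eq = cong₂ _+_ (Σ<-cong d eq) (eq d)

  Σ<-0# : ∀ d → Σ< d (λ _ → 0#) ≡ 0#
  Σ<-0# zero    = refl
  Σ<-0# (suc d) = trans (+-identityʳ _) (Σ<-0# d)

  Σ<-+ : ∀ d f g → Σ< d (λ i → f i + g i) ≡ Σ< d f + Σ< d g
  Σ<-+ zero    f g = sym (+-identityˡ 0#)
  Σ<-+ (suc d) f g = trans (cong (_+ (f d + g d)) (Σ<-+ d f g))
    (solve 4 (λ A B a b → (A :+ B) :+ (a :+ b) := (A :+ a) :+ (B :+ b)) refl (Σ< d f) (Σ< d g) (f d) (g d))

  Σ<-*ˡ : ∀ d c f → Σ< d (λ i → c * f i) ≡ c * Σ< d f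
  Σ<-*ˡ zero    c f = sym (zeroʳ c)
  Σ<-*ˡ (suc d) c f = trans (cong (_+ c * f d) (Σ<-*ˡ d c f)) (sym (distribˡ c _ _))

  Σ<-^2^ : ∀ d f k → Σ< d f ^2^ k ≡ Σ< d (λ i → f i ^2^ k)
  Σ<-^2^ zero    f k = 0^2^ k
  Σ<-^2^ (suc d) f k = trans (^2^-+ (Σ< d f) (f d) k) (cong (_+ f d ^2^ k) (Σ<-^2^ d f k))

  Σ<-shift : ∀ d f → f 0 + Σ< d (f ∘ suc) ≡ Σ< d f + f d
  Σ<-shift zero    f = trans (+-identityʳ (f 0)) (sym (+-identityˡ (f 0)))
  Σ<-shift (suc d) f = trans (sym (+-assoc _ _ _)) (cong (_+ f (suc d)) (Σ<-shift d f))

  Σ<-split : ∀ a b f → Σ< (a ℕ.+ b) f ≡ Σ< a f + Σ< b (λ j → f (a ℕ.+ j))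
  Σ<-split a zero    f = trans (cong (λ e → Σ< e f) (ℕₚ.+-identityʳ a)) (sym (+-identityʳ _))
  Σ<-split a (suc b) f = begin
    Σ< (a ℕ.+ suc b) f                                       ≡⟨ cong (λ e → Σ< e f) (ℕₚ.+-suc a b) ⟩
    Σ< (a ℕ.+ b) f + f (a ℕ.+ b)                             ≡⟨ cong (_+ f (a ℕ.+ b)) (Σ<-split a b f) ⟩
    (Σ< a f + Σ< b (λ j → f (a ℕ.+ j))) + f (a ℕ.+ b)        ≡⟨ +-assoc _ _ _ ⟩
    Σ< a f + Σ< (suc b) (λ j → f (a ℕ.+ j))                  ∎

  Σ<-comm : ∀ a b (f : ℕ → ℕ → F) → Σ< a (λ i → Σ< b (f i)) ≡ Σ< b (λ j → Σ< a (λ i → f i j))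
  Σ<-comm zero    b f = sym (Σ<-0# b)
  Σ<-comm (suc a) b f = trans (cong (_+ Σ< b (f a)) (Σ<-comm a b f)) (sym (Σ<-+ b _ _))

  Σ<-* : ∀ t r f → Σ< (t ℕ.* r) f ≡ Σ< t (λ i → Σ< r (λ j → f (i ℕ.* r ℕ.+ j)))
  Σ<-* zero    r f = refl
  Σ<-* (suc t) r f = begin
    Σ< (r ℕ.+ t ℕ.* r) f                                 ≡⟨ cong (λ e → Σ< e f) (ℕₚ.+-comm r (t ℕ.* r)) ⟩
    Σ< (t ℕ.* r ℕ.+ r) f                                 ≡⟨ Σ<-split (t ℕ.* r) r f ⟩
    Σ< (t ℕ.* r) f + Σ< r (λ j → f (t ℕ.* r ℕ.+ j))       ≡⟨ cong (_+ Σ< r (λ j → f (t ℕ.* r ℕ.+ j))) (Σ<-* t r f) ⟩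
    Σ< (suc t) (λ i → Σ< r (λ j → f (i ℕ.* r ℕ.+ j)))    ∎

  Tr-+ : ∀ k d x y → Tr k d (x + y) ≡ Tr k d x + Tr k d y
  Tr-+ k d x y = trans (Σ<-cong d (λ i → ^2^-+ x y (k ℕ.* i))) (Σ<-+ d _ _)

  Tr-0# : ∀ k d → Tr k d 0# ≡ 0#
  Tr-0# k d = trans (Σ<-cong d (λ i → 0^2^ (k ℕ.* i))) (Σ<-0# d)

  Tr-*ˡ : ∀ k d {c} → InSub k c → ∀ z → Tr k d (c * z) ≡ c * Tr k d z
  Tr-*ˡ k d {c} c∈ z = trans (Σ<-cong d scale) (Σ<-*ˡ d c _)
    where
    scale : ∀ i → (c * z) ^2^ (k ℕ.* i) ≡ c * z ^2^ (k ℕ.* i)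
    scale i = trans (^2^-* c z (k ℕ.* i)) (cong (_* z ^2^ (k ℕ.* i)) (InSub-multipleʳ {k} c∈ i))

  Tr-^2^ : ∀ k d z j → Tr k d (z ^2^ j) ≡ Tr k d z ^2^ j
  Tr-^2^ k d z j = trans (Σ<-cong d swap) (sym (Σ<-^2^ d _ j))
    where
    swap : ∀ i → (z ^2^ j) ^2^ (k ℕ.* i) ≡ (z ^2^ (k ℕ.* i)) ^2^ j
    swap i = trans (^2^-^2^ z j (k ℕ.* i))
               (trans (cong (z ^2^_) (ℕₚ.+-comm j (k ℕ.* i))) (sym (^2^-^2^ z (k ℕ.* i) j)))

  Tr-of-^2^ : ∀ k d z → Tr k d (z ^2^ k) ≡ Σ< d (λ i → z ^2^ (k ℕ.* suc i))
  Tr-of-^2^ k d z = Σ<-cong d (λ i →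
    trans (^2^-^2^ z k (k ℕ.* i)) (cong (z ^2^_) (sym (ℕₚ.*-suc k i))))

  Tr-closed : ∀ k d {z} → InSub (k ℕ.* d) z → InSub k (Tr k d z)
  Tr-closed k d {z} z∈ = begin
    Tr k d z ^2^ k       ≡⟨ sym (Tr-^2^ k d z k) ⟩
    Tr k d (z ^2^ k)     ≡⟨ Tr-of-^2^ k d z ⟩
    Σ< d (f ∘ suc)       ≡⟨ +-cancelˡ z _ _ (begin
      z + Σ< d (f ∘ suc)   ≡⟨ cong (_+ Σ< d (f ∘ suc)) (sym (^2^-k*0 k z)) ⟩
      f 0 + Σ< d (f ∘ suc) ≡⟨ Σ<-shift d f ⟩
      Σ< d f + f d         ≡⟨ cong (Σ< d f +_) z∈ ⟩
      Σ< d f + z           ≡⟨ +-comm _ z ⟩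
      z + Σ< d f           ∎) ⟩
    Tr k d z             ∎
    where
    f : ℕ → F
    f i = z ^2^ (k ℕ.* i)

  Tr-telescope : ∀ k d z → Tr k d (z ^2^ k + z) ≡ z ^2^ (k ℕ.* d) + z
  Tr-telescope k d z = begin
    Tr k d (z ^2^ k + z)           ≡⟨ Tr-+ k d (z ^2^ k) z ⟩
    Tr k d (z ^2^ k) + Σ< d f      ≡⟨ cong (_+ Σ< d f) (Tr-of-^2^ k d z) ⟩
    Σ< d (f ∘ suc) + Σ< d f        ≡⟨ +-swap-sides (f 0) _ _ _ (Σ<-shift d f) ⟩
    f d + f 0                      ≡⟨ cong (f d +_) (^2^-k*0 k z) ⟩
    z ^2^ (k ℕ.* d) + z            ∎
    where
    f : ℕ → F
    f i = z ^2^ (k ℕ.* i)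

  Tr-2 : ∀ k z → Tr k 2 z ≡ z + z ^2^ k
  Tr-2 k z = cong₂ _+_ (trans (+-identityˡ _) (^2^-k*0 k z)) (cong (z ^2^_) (ℕₚ.*-identityʳ k))

  Tr-tower : ∀ t r z → Tr 1 (t ℕ.* r) z ≡ Tr 1 r (Tr r t z)
  Tr-tower t r z = sym (begin
    Tr 1 r (Tr r t z)
      ≡⟨ Σ<-cong r (λ j → Σ<-^2^ t _ (1 ℕ.* j)) ⟩
    Σ< r (λ j → Σ< t (λ i → (z ^2^ (r ℕ.* i)) ^2^ (1 ℕ.* j)))
      ≡⟨ sym (Σ<-comm t r _) ⟩
    Σ< t (λ i → Σ< r (λ j → (z ^2^ (r ℕ.* i)) ^2^ (1 ℕ.* j)))
      ≡⟨ Σ<-cong t (λ i → Σ<-cong r (λ j → exponent i j)) ⟩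
    Σ< t (λ i → Σ< r (λ j → z ^2^ (1 ℕ.* (i ℕ.* r ℕ.+ j))))
      ≡⟨ sym (Σ<-* t r (λ l → z ^2^ (1 ℕ.* l))) ⟩
    Tr 1 (t ℕ.* r) z
      ∎)
    where
    exponent : ∀ i j → (z ^2^ (r ℕ.* i)) ^2^ (1 ℕ.* j) ≡ z ^2^ (1 ℕ.* (i ℕ.* r ℕ.+ j))
    exponent i j = trans (^2^-^2^ z (r ℕ.* i) (1 ℕ.* j)) (cong (z ^2^_)
      (trans (cong₂ ℕ._+_ (ℕₚ.*-comm r i) (ℕₚ.*-identityˡ j)) (sym (ℕₚ.*-identityˡ _))))

  IsBit : F → Set
  IsBit s = s ≡ 0# ⊎ s ≡ 1#

  InSub1⇒IsBit : ∀ {s} → InSub 1 s → IsBit s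
  InSub1⇒IsBit {s} s²≡s with no-zero-divisors s (s + 1#) s[s+1]≡0
    where
    s[s+1]≡0 : s * (s + 1#) ≡ 0#
    s[s+1]≡0 = begin
      s * (s + 1#)           ≡⟨ solve 1 (λ s → s :* (s :+ con 1) := s :* (s :* con 1) :+ s) refl s ⟩
      s * (s * 1#) + s       ≡⟨ cong (_+ s) s²≡s ⟩
      s + s                  ≡⟨ x+x≡0 s ⟩
      0#                     ∎
  ... | inj₁ s≡0   = inj₁ s≡0
  ... | inj₂ s+1≡0 = inj₂ (x+y≡0⇒x≡y s+1≡0)

  IsBit-≢0 : ∀ {s} → IsBit s → s ≢ 0# → s ≡ 1#
  IsBit-≢0 (inj₁ s≡0) s≢0 = contradiction s≡0 s≢0
  IsBit-≢0 (inj₂ s≡1) _   = s≡1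

  Tr₁-closed : ∀ M {z} → InSub M z → InSub 1 (Tr 1 M z)
  Tr₁-closed M {z} z∈ = Tr-closed 1 M (subst (λ e → InSub e z) (sym (ℕₚ.*-identityˡ M)) z∈)

  Tr₁-bit : ∀ M {z} → InSub M z → IsBit (Tr 1 M z)
  Tr₁-bit M z∈ = InSub1⇒IsBit (Tr₁-closed M z∈)

  Tr₁-^2^ : ∀ M {z} → InSub M z → ∀ k → Tr 1 M (z ^2^ k) ≡ Tr 1 M z
  Tr₁-^2^ M {z} z∈ k = trans (Tr-^2^ 1 M z k)
    (subst (λ e → Tr 1 M z ^2^ e ≡ Tr 1 M z) (ℕₚ.*-identityˡ k) (InSub-multipleʳ {1} (Tr₁-closed M z∈) k))

  -- Counting elements and roots

  enumerate : ∀ {P : Pred F 0ℓ} → Decidable P → List F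
  enumerate P? = filter P? elems

  enumerate! : ∀ {P : Pred F 0ℓ} (P? : Decidable P) → Unique (enumerate P?)
  enumerate! P? = filter⁺ P? elems-unique

  ∈enumerate⁺ : ∀ {P : Pred F 0ℓ} (P? : Decidable P) {z} → P z → z ∈ enumerate P?
  ∈enumerate⁺ P? {z} = ∈-filter⁺ P? (elems-complete z)

  ∈enumerate⁻ : ∀ {P : Pred F 0ℓ} (P? : Decidable P) {z} → z ∈ enumerate P? → P z
  ∈enumerate⁻ P? z∈ = proj₂ (∈-filter⁻ P? {xs = elems} z∈)

  count : ∀ {P : Pred F 0ℓ} → Decidable P → ℕ
  count P? = Σℕ.∑ elems (λ z → Σℕ.when (P? z) 1)

  length-enumerate : ∀ {P : Pred F 0ℓ} (P? : Decidable P) → length (enumerate P?) ≡ count P?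
  length-enumerate P? = Σℕ.length-filter P? elems

  count-⇔ : ∀ {P Q : Pred F 0ℓ} (P? : Decidable P) (Q? : Decidable Q) →
            (∀ {z} → P z → Q z) → (∀ {z} → Q z → P z) → count P? ≡ count Q?
  count-⇔ P? Q? to from = Σℕ.∑-congˡ elems (λ z → Σℕ.when-⇔ to from (P? z) (Q? z) 1)

  count-none : ∀ {P : Pred F 0ℓ} (P? : Decidable P) → (∀ {z} → ¬ P z) → count P? ≡ 0
  count-none P? ∄ = Σℕ.∑-when-none elems P? 1 (λ _ → ∄)

  count-all : ∀ {P : Pred F 0ℓ} (P? : Decidable P) → (∀ z → P z) → count P? ≡ 2 ^ n
  count-all P? all = begin
    count P?                ≡⟨ sym (length-enumerate P?) ⟩
    length (filter P? elems) ≡⟨ cong length (filter-all P? {elems} (All.tabulate (λ {z} _ → all z))) ⟩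
    length elems            ≡⟨ elems-card ⟩
    2 ^ n                   ∎

  ∃? : ∀ {P : Pred F 0ℓ} → Decidable P → Dec (∃ P)
  ∃? P? with any? P? elems
  ... | yes some = yes (Any.satisfied some)
  ... | no none  = no λ (z , pz) → none (Any.map (λ { refl → pz }) (elems-complete z))

  count-<⇒∃ : ∀ {P Q : Pred F 0ℓ} (P? : Decidable P) (Q? : Decidable Q) →
              count (P? ∩? Q?) ℕ.< count P? → ∃ λ z → P z × ¬ Q z
  count-<⇒∃ {P} {Q} P? Q? lt with ∃? (P? ∩? ∁? Q?)
  ... | yes witness = witness
  ... | no ∄ = contradiction (count-⇔ (P? ∩? Q?) P? proj₁ P⇒Q) (ℕₚ.<⇒≢ lt)
    where
    P⇒Q : ∀ {z} → P z → P z × Q z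
    P⇒Q {z} pz with Q? z
    ... | yes qz = pz , qz
    ... | no ¬qz = contradiction (z , pz , ¬qz) ∄

  -- Coefficient lists start with the constant term; monic cs has degree length cs.
  eval : List F → F → F
  eval []       z = 0#
  eval (c ∷ cs) z = c + z * eval cs z

  monic : List F → F → F
  monic []       z = 1#
  monic (c ∷ cs) z = c + z * monic cs z

  deflate : F → List F → List F
  deflate a []       = []
  deflate a (c ∷ cs) = monic (c ∷ cs) a ∷ deflate a cs

  length-deflate : ∀ a cs → length (deflate a cs) ≡ length cs
  length-deflate a []       = refl
  length-deflate a (c ∷ cs) = cong suc (length-deflate a cs)

  monic-factor : ∀ a c cs z → monic (c ∷ cs) z + monic (c ∷ cs) a ≡ (z + a) * monic (deflate a cs) z
  monic-factor a c [] z = begin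
    (c + z * 1#) + (c + a * 1#)   ≡⟨ solve 3 (λ c z a → (c :+ z :* con 1) :+ (c :+ a :* con 1) :=
                                                         (c :+ c) :+ (z :+ a) :* con 1) refl c z a ⟩
    (c + c) + (z + a) * 1#        ≡⟨ cong (_+ (z + a) * 1#) (x+x≡0 c) ⟩
    0# + (z + a) * 1#             ≡⟨ +-identityˡ _ ⟩
    (z + a) * 1#                  ∎
  monic-factor a c (c′ ∷ cs) z = begin
    (c + z * Pz) + (c + a * Pa)
      ≡⟨ solve 5 (λ c z a Pz Pa → (c :+ z :* Pz) :+ (c :+ a :* Pa) := (c :+ c) :+ (z :* Pz :+ a :* Pa))
                 refl c z a Pz Pa ⟩
    (c + c) + (z * Pz + a * Pa)
      ≡⟨ cong (_+ (z * Pz + a * Pa)) (trans (x+x≡0 c) (sym (x+x≡0 (z * Pa)))) ⟩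
    (z * Pa + z * Pa) + (z * Pz + a * Pa)
      ≡⟨ solve 4 (λ z a Pz Pa → (z :* Pa :+ z :* Pa) :+ (z :* Pz :+ a :* Pa) := (z :+ a) :* Pa :+ z :* (Pz :+ Pa))
                 refl z a Pz Pa ⟩
    (z + a) * Pa + z * (Pz + Pa)
      ≡⟨ cong (λ w → (z + a) * Pa + z * w) (monic-factor a c′ cs z) ⟩
    (z + a) * Pa + z * ((z + a) * Q)
      ≡⟨ solve 4 (λ z a Pa Q → (z :+ a) :* Pa :+ z :* ((z :+ a) :* Q) := (z :+ a) :* (Pa :+ z :* Q)) refl z a Pa Q ⟩
    (z + a) * (Pa + z * Q)
      ∎
    where
    Pz Pa Q : F
    Pz = monic (c′ ∷ cs) z
    Pa = monic (c′ ∷ cs) a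
    Q  = monic (deflate a cs) z

  monic-roots : ∀ cs {L} → Unique L → (∀ {z} → z ∈ L → monic cs z ≡ 0#) → length L ℕ.≤ length cs
  monic-roots cs       {[]}    _ _ = z≤n
  monic-roots []       {a ∷ L} _ roots = contradiction (sym (roots (here refl))) 0≢1
  monic-roots (c ∷ cs) {a ∷ L} (a∉L AllPairs.∷ L!) roots =
    s≤s (subst (length L ℕ.≤_) (length-deflate a cs) (monic-roots (deflate a cs) L! deflated-roots))
    where
    deflated-roots : ∀ {z} → z ∈ L → monic (deflate a cs) z ≡ 0#
    deflated-roots {z} z∈L with no-zero-divisors (z + a) (monic (deflate a cs) z)
      (trans (sym (monic-factor a c cs z))
             (trans (cong₂ _+_ (roots (there z∈L)) (roots (here refl))) (+-identityˡ 0#)))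
    ... | inj₁ z+a≡0 = contradiction (sym (x+y≡0⇒x≡y z+a≡0)) (All.lookup a∉L z∈L)
    ... | inj₂ q≡0   = q≡0

  monic-completion : ∀ D cs → length cs ℕ.≤ D →
                     ∃ λ ds → length ds ≡ D × (∀ z → monic ds z ≡ pow z D + eval cs z)
  monic-completion zero    []       _ = [] , refl , λ _ → sym (+-identityʳ 1#)
  monic-completion (suc D) []       _ with monic-completion D [] z≤n
  ... | ds , ds≡D , ds≗ = 0# ∷ ds , cong suc ds≡D , λ z → begin
    0# + z * monic ds z         ≡⟨ cong (λ w → 0# + z * w) (ds≗ z) ⟩
    0# + z * (pow z D + 0#)     ≡⟨ solve 2 (λ z p → con 0 :+ z :* (p :+ con 0) := z :* p :+ con 0)
                                           refl z (pow z D) ⟩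
    z * pow z D + 0#            ∎
  monic-completion (suc D) (c ∷ cs) (s≤s cs≤D) with monic-completion D cs cs≤D
  ... | ds , ds≡D , ds≗ = c ∷ ds , cong suc ds≡D , λ z → begin
    c + z * monic ds z                 ≡⟨ cong (λ w → c + z * w) (ds≗ z) ⟩
    c + z * (pow z D + eval cs z)      ≡⟨ solve 4 (λ c z p e → c :+ z :* (p :+ e) := z :* p :+ (c :+ z :* e))
                                                  refl c z (pow z D) (eval cs z) ⟩
    z * pow z D + (c + z * eval cs z)  ∎

  Poly< : ℕ → (F → F) → Set
  Poly< D f = ∃ λ cs → length cs ℕ.≤ D × (∀ z → f z ≡ eval cs z)

  _⊕_ : List F → List F → List F
  []       ⊕ ds       = ds
  (c ∷ cs) ⊕ []       = c ∷ cs
  (c ∷ cs) ⊕ (d ∷ ds) = (c + d) ∷ (cs ⊕ ds)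

  eval-⊕ : ∀ cs ds z → eval (cs ⊕ ds) z ≡ eval cs z + eval ds z
  eval-⊕ []       ds       z = sym (+-identityˡ _)
  eval-⊕ (c ∷ cs) []       z = sym (+-identityʳ _)
  eval-⊕ (c ∷ cs) (d ∷ ds) z = trans (cong (λ w → (c + d) + z * w) (eval-⊕ cs ds z))
    (solve 5 (λ c d z p q → (c :+ d) :+ z :* (p :+ q) := (c :+ z :* p) :+ (d :+ z :* q))
             refl c d z (eval cs z) (eval ds z))

  length-⊕ : ∀ {D} cs ds → length cs ℕ.≤ D → length ds ℕ.≤ D → length (cs ⊕ ds) ℕ.≤ D
  length-⊕ []       ds       _         ds≤D      = ds≤D
  length-⊕ (c ∷ cs) []       cs≤D      _         = cs≤D
  length-⊕ (c ∷ cs) (d ∷ ds) (s≤s cs≤D) (s≤s ds≤D) = s≤s (length-⊕ cs ds cs≤D ds≤D)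

  Poly<-0# : ∀ {D} → Poly< D (λ _ → 0#)
  Poly<-0# = [] , z≤n , λ _ → refl

  Poly<-+ : ∀ {D f g} → Poly< D f → Poly< D g → Poly< D (λ z → f z + g z)
  Poly<-+ (cs , cs≤D , f≗) (ds , ds≤D , g≗) =
    cs ⊕ ds , length-⊕ cs ds cs≤D ds≤D , λ z → trans (cong₂ _+_ (f≗ z) (g≗ z)) (sym (eval-⊕ cs ds z))

  Poly<-pow : ∀ {D j} → j ℕ.< D → Poly< D (λ z → pow z j)
  Poly<-pow {D} {j} j<D =
    monomial j , subst (ℕ._≤ D) (sym (length-monomial j)) j<D , λ z → sym (eval-monomial j z)
    where
    monomial : ℕ → List F
    monomial zero    = 1# ∷ []
    monomial (suc j) = 0# ∷ monomial j
    length-monomial : ∀ j → length (monomial j) ≡ suc j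
    length-monomial zero    = refl
    length-monomial (suc j) = cong suc (length-monomial j)
    eval-monomial : ∀ j z → eval (monomial j) z ≡ pow z j
    eval-monomial zero    z = trans (cong (1# +_) (zeroʳ z)) (+-identityʳ 1#)
    eval-monomial (suc j) z = trans (+-identityˡ _) (cong (z *_) (eval-monomial j z))

  Poly<-Σ< : ∀ {D} d {f : ℕ → F → F} → (∀ {i} → i ℕ.< d → Poly< D (f i)) →
             Poly< D (λ z → Σ< d (λ i → f i z))
  Poly<-Σ< zero    f< = Poly<-0#
  Poly<-Σ< (suc d) f< = Poly<-+ (Poly<-Σ< d (f< ∘ ℕₚ.m<n⇒m<1+n)) (f< ℕₚ.≤-refl)

  Poly<-Tr : ∀ k d .{{_ : ℕ.NonZero k}} → Poly< (2 ^ (k ℕ.* d)) (Tr k d)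
  Poly<-Tr k d = Poly<-Σ< d (λ i<d → Poly<-pow (2^-mono-< (ℕₚ.*-monoʳ-< k i<d)))

  roots-count : ∀ {D p} → Poly< D p → ∀ {P : Pred F 0ℓ} (P? : Decidable P) →
                (∀ {z} → P z → pow z D + p z ≡ 0#) → count P? ℕ.≤ D
  roots-count {D} {p} (cs , cs≤D , p≗) P? roots with monic-completion D cs cs≤D
  ... | ds , ds≡D , ds≗ = subst₂ ℕ._≤_ (length-enumerate P?) ds≡D
    (monic-roots ds (enumerate! P?) λ {z} z∈ →
      trans (ds≗ z) (trans (cong (pow z D +_) (sym (p≗ z))) (roots (∈enumerate⁻ P? z∈))))

  -- Orders of subfields and trace kernels

  count-^2^-fixed : ∀ k .{{_ : ℕ.NonZero k}} {P : Pred F 0ℓ} (P? : Decidable P) →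
                    (∀ {z} → P z → z ^2^ k + z ≡ 0#) → count P? ℕ.≤ 2 ^ k
  count-^2^-fixed k P? fixed = roots-count (Poly<-pow (2^-mono-< (ℕ.>-nonZero⁻¹ k))) P?
    (λ {z} pz → trans (cong (z ^2^ k +_) (*-identityʳ z)) (fixed pz))

  count-Tr-roots : ∀ k d .{{_ : ℕ.NonZero k}} {P : Pred F 0ℓ} (P? : Decidable P) →
                   (∀ {z} → P z → Tr k (suc d) z ≡ 0#) → count P? ℕ.≤ 2 ^ (k ℕ.* d)
  count-Tr-roots k d P? roots = roots-count (Poly<-Tr k d) P? (λ pz → trans (+-comm _ _) (roots pz))

  -- |P| = |ker T| · |T(P)| and T(P) ⊆ ker U.
  module Kernels {P : Pred F 0ℓ} (P? : Decidable P) (P-+ : ∀ {x y} → P x → P y → P (x + y))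
                 (T U : F → F) (T-+ : ∀ x y → T (x + y) ≡ T x + T y)
                 (T-P : ∀ {z} → P z → P (T z)) (U∘T≡0 : ∀ {z} → P z → U (T z) ≡ 0#) where

    ker? : (f : F → F) → Decidable (P ∩ (λ z → f z ≡ 0#))
    ker? f = P? ∩? (λ z → f z ≟ 0#)

    fibre : F → ℕ
    fibre y = count (P? ∩? (λ z → T z ≟ y))

    fibre-image : ∀ {z₀} → P z₀ → fibre (T z₀) ≡ count (ker? T)
    fibre-image {z₀} z₀∈ = begin
      fibre (T z₀)
        ≡⟨ sym (Σℕ.∑-reindex elems-unique (_+ z₀) (_+ z₀) (λ z → x+y+y≡x z z₀) (λ z → x+y+y≡x z z₀)
                 (λ _ → elems-complete _) (λ _ → elems-complete _) _) ⟩
      Σℕ.∑ elems (λ z → Σℕ.when (P? (z + z₀) ×-dec (T (z + z₀) ≟ T z₀)) 1)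
        ≡⟨ Σℕ.∑-congˡ elems (λ z → Σℕ.when-⇔ to from _ _ 1) ⟩
      count (ker? T) ∎
      where
      to : ∀ {z} → P (z + z₀) × T (z + z₀) ≡ T z₀ → P z × T z ≡ 0#
      to {z} (pz+z₀ , eq) = subst P (x+y+y≡x z z₀) (P-+ pz+z₀ z₀∈) ,
        +-cancelʳ (T z₀) (T z) 0# (trans (sym (T-+ z z₀)) (trans eq (sym (+-identityˡ (T z₀)))))
      from : ∀ {z} → P z × T z ≡ 0# → P (z + z₀) × T (z + z₀) ≡ T z₀
      from {z} (pz , Tz≡0) = P-+ pz z₀∈ , trans (T-+ z z₀) (trans (cong (_+ T z₀) Tz≡0) (+-identityˡ (T z₀)))

    fibre-bound : ∀ y → fibre y ℕ.≤ Σℕ.when (ker? U y) 1 ℕ.* count (ker? T)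
    fibre-bound y with ∃? (P? ∩? (λ z → T z ≟ y))
    ... | yes (z₀ , z₀∈ , refl) = ℕₚ.≤-reflexive (begin
      fibre (T z₀)                                            ≡⟨ fibre-image z₀∈ ⟩
      count (ker? T)                                          ≡⟨ sym (ℕₚ.+-identityʳ _) ⟩
      1 ℕ.* count (ker? T)                                    ≡⟨ cong (ℕ._* count (ker? T))
                                                                   (sym (Σℕ.when-yes (T-P z₀∈ , U∘T≡0 z₀∈) (ker? U (T z₀)) 1)) ⟩
      Σℕ.when (ker? U (T z₀)) 1 ℕ.* count (ker? T)            ∎)
    ... | no ∄ = ℕₚ.≤-trans (ℕₚ.≤-reflexive (count-none (P? ∩? (λ z → T z ≟ y)) (λ p → ∄ (_ , p)))) z≤n

    count≤ker*ker : count P? ℕ.≤ count (ker? U) ℕ.* count (ker? T)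
    count≤ker*ker = ℕₚ.≤-trans (ℕₚ.≤-reflexive count≡∑fibre)
      (ℕₚ.≤-trans (Σℕ.∑-mono-≤ elems fibre-bound) (ℕₚ.≤-reflexive (Σℕ.∑-*ʳ elems _ (count (ker? T)))))
      where
      unique-image : ∀ z → Σℕ.when (P? z) 1 ≡ Σℕ.∑ elems (λ y → Σℕ.when (P? z ×-dec (T z ≟ y)) 1)
      unique-image z with P? z
      ... | yes pz = sym (Σℕ.∑-when-unique elems-unique (λ y → yes pz ×-dec (T z ≟ y)) 1
                            (elems-complete (T z)) (pz , refl) (λ (_ , eq) → sym eq))
      ... | no ¬pz = sym (Σℕ.∑-when-none elems (λ y → no ¬pz ×-dec (T z ≟ y)) 1 (λ _ (pz , _) → ¬pz pz))
      count≡∑fibre : count P? ≡ Σℕ.∑ elems fibre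
      count≡∑fibre = trans (Σℕ.∑-congˡ elems unique-image) (Σℕ.∑-swap elems elems _)

  subfield-sizes : ∀ k d .{{_ : ℕ.NonZero k}} → count (inSub? (suc d ℕ.* k)) ≡ 2 ^ (suc d ℕ.* k) →
                   count (inSub? k) ≡ 2 ^ k ×
                   count (inSub? (suc d ℕ.* k) ∩? (λ z → Tr k (suc d) z ≟ 0#)) ≡ 2 ^ (d ℕ.* k)
  subfield-sizes k d |F_M| =
    trans (count-⇔ (inSub? k) (ker? T) F_k⊆ker ker⊆F_k) (proj₁ squeezed) , proj₂ squeezed
    where
    M : ℕ
    M = suc d ℕ.* k
    T : F → F
    T z = z ^2^ k + z
    T-+ : ∀ x y → T (x + y) ≡ T x + T y
    T-+ x y = trans (cong (_+ (x + y)) (^2^-+ x y k))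
      (solve 4 (λ X Y x y → (X :+ Y) :+ (x :+ y) := (X :+ x) :+ (Y :+ y)) refl (x ^2^ k) (y ^2^ k) x y)
    U∘T≡0 : ∀ {z} → InSub M z → Tr k (suc d) (T z) ≡ 0#
    U∘T≡0 {z} z∈ = trans (Tr-telescope k (suc d) z)
      (x≡y⇒x+y≡0 (subst (λ e → InSub e z) (ℕₚ.*-comm (suc d) k) z∈))
    open Kernels (inSub? M) (InSub-+ {M}) T (Tr k (suc d)) T-+
                 (λ z∈ → InSub-+ {M} (InSub-^2^ {M} z∈ k) z∈) U∘T≡0
    F_k⊆ker : ∀ {z} → InSub k z → InSub M z × T z ≡ 0#
    F_k⊆ker {z} z∈ = InSub-multipleˡ {k} z∈ (suc d) , x≡y⇒x+y≡0 z∈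
    ker⊆F_k : ∀ {z} → InSub M z × T z ≡ 0# → InSub k z
    ker⊆F_k (_ , Tz≡0) = x+y≡0⇒x≡y Tz≡0
    kerT≤ : count (ker? T) ℕ.≤ 2 ^ k
    kerT≤ = count-^2^-fixed k (ker? T) proj₂
    kerU≤ : count (ker? (Tr k (suc d))) ℕ.≤ 2 ^ (d ℕ.* k)
    kerU≤ = subst (λ e → count (ker? (Tr k (suc d))) ℕ.≤ 2 ^ e) (ℕₚ.*-comm k d)
                  (count-Tr-roots k d (ker? (Tr k (suc d))) proj₂)
    |F_M|≤ : 2 ^ k ℕ.* 2 ^ (d ℕ.* k) ℕ.≤ count (ker? T) ℕ.* count (ker? (Tr k (suc d)))
    |F_M|≤ = subst₂ ℕ._≤_ (trans |F_M| (ℕₚ.^-distribˡ-+-* 2 k (d ℕ.* k)))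
                          (ℕₚ.*-comm (count (ker? (Tr k (suc d)))) (count (ker? T))) count≤ker*ker
    squeezed : count (ker? T) ≡ 2 ^ k × count (ker? (Tr k (suc d))) ≡ 2 ^ (d ℕ.* k)
    squeezed = *-squeeze {{ℕₚ.m^n≢0 2 k}} {{ℕₚ.m^n≢0 2 (d ℕ.* k)}} kerT≤ kerU≤ |F_M|≤

  Tr₁-nondegenerate : ∀ M .{{_ : ℕ.NonZero M}} → count (inSub? M) ≡ 2 ^ M → ∃ λ w → InSub M w × Tr 1 M w ≢ 0#
  Tr₁-nondegenerate (suc M) |F_M| = count-<⇒∃ (inSub? (suc M)) (λ z → Tr 1 (suc M) z ≟ 0#)
    (ℕₚ.≤-<-trans (count-Tr-roots 1 M _ proj₂)
      (subst (2 ^ (1 ℕ.* M) ℕ.<_) (sym |F_M|) (2^-mono-< (s≤s (ℕₚ.≤-reflexive (ℕₚ.*-identityˡ M))))))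

  -- Additive characters

  sgn-0# : sgn 0# ≡ 1ℚ
  sgn-0# with 0# ≟ 0#
  ... | yes _   = refl
  ... | no 0≢0  = contradiction refl 0≢0

  sgn-1# : sgn 1# ≡ ℚ.- 1ℚ
  sgn-1# with 1# ≟ 0#
  ... | yes 1≡0 = contradiction (sym 1≡0) 0≢1
  ... | no _    = refl

  sgn-+ : ∀ {s u} → IsBit s → IsBit u → sgn (s + u) ≡ sgn s ℚ.* sgn u
  sgn-+ (inj₁ refl) (inj₁ refl) = trans (cong sgn (+-identityˡ 0#)) (trans sgn-0# (sym (cong₂ ℚ._*_ sgn-0# sgn-0#)))
  sgn-+ (inj₁ refl) (inj₂ refl) = trans (cong sgn (+-identityˡ 1#)) (trans sgn-1# (sym (cong₂ ℚ._*_ sgn-0# sgn-1#)))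
  sgn-+ (inj₂ refl) (inj₁ refl) = trans (cong sgn (+-identityʳ 1#)) (trans sgn-1# (sym (cong₂ ℚ._*_ sgn-1# sgn-0#)))
  sgn-+ (inj₂ refl) (inj₂ refl) = trans (cong sgn 1+1≡0) (trans sgn-0# (sym (cong₂ ℚ._*_ sgn-1# sgn-1#)))

  sgn-+1 : ∀ {s} → IsBit s → sgn (s + 1#) ≡ ℚ.- sgn s
  sgn-+1 (inj₁ refl) = trans (cong sgn (+-identityˡ 1#)) (trans sgn-1# (cong ℚ.-_ (sym sgn-0#)))
  sgn-+1 (inj₂ refl) = trans (cong sgn 1+1≡0) (trans sgn-0# (cong ℚ.-_ (sym sgn-1#)))

  ∑-sgn-trivial : ∀ L (φ : F → F) → (∀ {a} → a ∈ L → φ a ≡ 0#) → Σℚ.∑ L (sgn ∘ φ) ≡ length L Σℚ.· 1ℚ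
  ∑-sgn-trivial L φ φ≡0 = trans (Σℚ.∑-cong L (λ a∈ → trans (cong sgn (φ≡0 a∈)) sgn-0#)) (Σℚ.∑-const L 1ℚ)

  ∑-sgn-balanced : ∀ {L} → Unique L → (φ : F → F) → (∀ {a} → a ∈ L → IsBit (φ a)) →
                   (∀ a b → φ (a + b) ≡ φ a + φ b) →
                   ∀ {a₀} → (∀ {a} → a ∈ L → a + a₀ ∈ L) → φ a₀ ≡ 1# → Σℚ.∑ L (sgn ∘ φ) ≡ 0ℚ
  ∑-sgn-balanced {L} L! φ bit φ-+ {a₀} +a₀-∈ φa₀≡1 = x≡-x⇒x≡0 (begin
    Σℚ.∑ L (sgn ∘ φ)                  ≡⟨ sym (Σℚ.∑-reindex L! (_+ a₀) (_+ a₀) (λ a → x+y+y≡x a a₀) (λ a → x+y+y≡x a a₀)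
                                                             +a₀-∈ +a₀-∈ (sgn ∘ φ)) ⟩
    Σℚ.∑ L (λ a → sgn (φ (a + a₀)))   ≡⟨ Σℚ.∑-cong L flip ⟩
    Σℚ.∑ L (λ a → ℚ.- sgn (φ a))      ≡⟨ Σℚ.∑-neg L (sgn ∘ φ) ⟩
    ℚ.- Σℚ.∑ L (sgn ∘ φ)              ∎)
    where
    flip : ∀ {a} → a ∈ L → sgn (φ (a + a₀)) ≡ ℚ.- sgn (φ a)
    flip {a} a∈ = trans (cong sgn (trans (φ-+ a a₀) (cong (φ a +_) φa₀≡1))) (sgn-+1 (bit a∈))

  vsum-e : ∀ {P : Pred F 0ℓ} (P? : Decidable P) x → vsum (enumerate P?) (e K) x ≡ Σℚ.when (P? x) 1ℚ
  vsum-e P? x =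
    trans (vsum-∑ (enumerate P?) (e K) x) (trans (Σℚ.∑-congˡ (enumerate P?) e≡when) (indicator (P? x)))
    where
    e≡when : ∀ y → e K y x ≡ Σℚ.when (x ≟ y) 1ℚ
    e≡when y with x ≟ y
    ... | yes _ = refl
    ... | no _  = refl
    indicator : (x? : Dec _) → Σℚ.∑ (enumerate P?) (λ y → Σℚ.when (x ≟ y) 1ℚ) ≡ Σℚ.when x? 1ℚ
    indicator (yes px) = Σℚ.∑-when-unique (enumerate! P?) (x ≟_) 1ℚ (∈enumerate⁺ P? px) refl sym
    indicator (no ¬px) = Σℚ.∑-when-none (enumerate P?) (x ≟_) 1ℚ
                           (λ y∈ x≡y → ¬px (subst _ (sym x≡y) (∈enumerate⁻ P? y∈)))

-- The coordinates of the double sum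

module Setting (t′ r : ℕ) .{{_ : ℕ.NonZero r}} (K : GF2^ (2 ℕ.* (suc t′ ℕ.* r))) where
  open FiniteField K
  open ≡-Reasoning

  t m : ℕ
  t = suc t′
  m = t ℕ.* r

  instance
    m≢0 : ℕ.NonZero m
    m≢0 = ℕₚ.m*n≢0 t r

  |F_m| : count (inSub? m) ≡ 2 ^ m
  |F_m| = proj₁ (subfield-sizes m 1 (count-all (inSub? (2 ℕ.* m)) x^2^n≡x))

  A? : Decidable (InSub r)
  A? = inSub? r

  B? : Decidable (InSub m ∩ (λ b → Tr r t b ≡ 0#))
  B? = inSub? m ∩? (λ b → Tr r t b ≟ 0#)

  |F_r| : count A? ≡ 2 ^ r
  |F_r| = proj₁ (subfield-sizes r t′ |F_m|)

  |A| : length (enumerate A?) ≡ 2 ^ r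
  |A| = trans (length-enumerate A?) |F_r|

  |B| : length (enumerate B?) ≡ 2 ^ (t′ ℕ.* r)
  |B| = trans (length-enumerate B?) (proj₂ (subfield-sizes r t′ |F_m|))

  ^2^m-involutive : ∀ z → (z ^2^ m) ^2^ m ≡ z
  ^2^m-involutive z = trans (^2^-^2^ z m m) (trans (cong (λ e → z ^2^ (m ℕ.+ e)) (sym (ℕₚ.+-identityʳ m))) (x^2^n≡x z))

  module AtPoint (x : F) where
    N c y : F
    N = pow x (2 ^ m ℕ.+ 1)
    c = Tr r t N
    y = x + x ^2^ m

    u v : F → F
    u a = Tr 1 m (a * N)
    v b = Tr 1 (2 ℕ.* m) (b * x)

    N∈F_m : InSub m N
    N∈F_m = begin
      N ^2^ m                           ≡⟨ cong (_^2^ m) N≡ ⟩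
      (x ^2^ m * x) ^2^ m               ≡⟨ ^2^-* (x ^2^ m) x m ⟩
      (x ^2^ m) ^2^ m * x ^2^ m         ≡⟨ cong (_* x ^2^ m) (^2^m-involutive x) ⟩
      x * x ^2^ m                       ≡⟨ *-comm x (x ^2^ m) ⟩
      x ^2^ m * x                       ≡⟨ sym N≡ ⟩
      N                                 ∎
      where
      N≡ : N ≡ x ^2^ m * x
      N≡ = trans (pow-+ x (2 ^ m) 1) (cong (x ^2^ m *_) (*-identityʳ x))

    y∈F_m : InSub m y
    y∈F_m = trans (^2^-+ x (x ^2^ m) m) (trans (cong (x ^2^ m +_) (^2^m-involutive x)) (+-comm (x ^2^ m) x))

    c∈F_r : InSub r c
    c∈F_r = Tr-closed r t (subst (λ e → InSub e N) (ℕₚ.*-comm t r) N∈F_m)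

    u≡ : ∀ {a} → InSub r a → u a ≡ Tr 1 r (a * c)
    u≡ {a} a∈ = trans (Tr-tower t r (a * N)) (cong (Tr 1 r) (Tr-*ˡ r t a∈ N))

    u-bit : ∀ {a} → InSub r a → IsBit (u a)
    u-bit {a} a∈ = Tr₁-bit m (InSub-* {m} (InSub-multipleˡ {r} a∈ t) N∈F_m)

    u-+ : ∀ a b → u (a + b) ≡ u a + u b
    u-+ a b = trans (cong (Tr 1 m) (distribʳ N a b)) (Tr-+ 1 m _ _)

    v≡ : ∀ {b} → InSub m b → v b ≡ Tr 1 m (b * y)
    v≡ {b} b∈ = trans (Tr-tower 2 m (b * x)) (cong (Tr 1 m) (begin
      Tr m 2 (b * x)            ≡⟨ Tr-2 m (b * x) ⟩
      b * x + (b * x) ^2^ m     ≡⟨ cong (b * x +_) (trans (^2^-* b x m) (cong (_* x ^2^ m) b∈)) ⟩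
      b * x + b * x ^2^ m       ≡⟨ sym (distribˡ b x (x ^2^ m)) ⟩
      b * y                     ∎))

    v-bit : ∀ b → IsBit (v b)
    v-bit b = Tr₁-bit (2 ℕ.* m) (x^2^n≡x (b * x))

    v-+ : ∀ a b → v (a + b) ≡ v a + v b
    v-+ a b = trans (cong (Tr 1 (2 ℕ.* m)) (distribʳ x a b)) (Tr-+ 1 (2 ℕ.* m) _ _)

    sumA sumB : ℚ
    sumA = Σℚ.∑ (enumerate A?) (sgn ∘ u)
    sumB = Σℚ.∑ (enumerate B?) (sgn ∘ v)

    sumA-trivial : c ≡ 0# → sumA ≡ (2 ^ r) Σℚ.· 1ℚ
    sumA-trivial c≡0 = trans (∑-sgn-trivial (enumerate A?) u ua≡0) (cong (Σℚ._· 1ℚ) |A|)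
      where
      ua≡0 : ∀ {a} → a ∈ enumerate A? → u a ≡ 0#
      ua≡0 {a} a∈ = trans (u≡ (∈enumerate⁻ A? a∈))
        (trans (cong (λ w → Tr 1 r (a * w)) c≡0) (trans (cong (Tr 1 r) (zeroʳ a)) (Tr-0# 1 r)))

    sumA-balanced : c ≢ 0# → sumA ≡ 0ℚ
    sumA-balanced c≢0 = balanced (inverse c c≢0) (Tr₁-nondegenerate r |F_r|)
      where
      balanced : (∃ λ c⁻¹ → c * c⁻¹ ≡ 1#) → (∃ λ w → InSub r w × Tr 1 r w ≢ 0#) → sumA ≡ 0ℚ
      balanced (c⁻¹ , cc⁻¹≡1) (w , w∈ , Trw≢0) = ∑-sgn-balanced (enumerate! A?) u (u-bit ∘ ∈enumerate⁻ A?) u-+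
        (λ a∈ → ∈enumerate⁺ A? (InSub-+ {r} (∈enumerate⁻ A? a∈) a₀∈)) ua₀≡1
        where
        a₀ : F
        a₀ = w * c⁻¹
        a₀∈ : InSub r a₀
        a₀∈ = InSub-* {r} w∈ (InSub-⁻¹ {r} c∈F_r cc⁻¹≡1)
        a₀c≡w : a₀ * c ≡ w
        a₀c≡w = trans (*-assoc w c⁻¹ c) (trans (cong (w *_) (trans (*-comm c⁻¹ c) cc⁻¹≡1)) (*-identityʳ w))
        ua₀≡1 : u a₀ ≡ 1#
        ua₀≡1 = IsBit-≢0 (u-bit a₀∈) λ ua₀≡0 →
          Trw≢0 (trans (cong (Tr 1 r) (sym a₀c≡w)) (trans (sym (u≡ a₀∈)) ua₀≡0))

    sumB-trivial : InSub r y → sumB ≡ (2 ^ (t′ ℕ.* r)) Σℚ.· 1ℚ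
    sumB-trivial y∈F_r = trans (∑-sgn-trivial (enumerate B?) v vb≡0) (cong (Σℚ._· 1ℚ) |B|)
      where
      vb≡0 : ∀ {b} → b ∈ enumerate B? → v b ≡ 0#
      vb≡0 {b} b∈ with ∈enumerate⁻ B? b∈
      ... | b∈F_m , Trb≡0 = begin
        v b                         ≡⟨ v≡ b∈F_m ⟩
        Tr 1 m (b * y)              ≡⟨ Tr-tower t r (b * y) ⟩
        Tr 1 r (Tr r t (b * y))     ≡⟨ cong (Tr 1 r) (trans (cong (Tr r t) (*-comm b y)) (Tr-*ˡ r t y∈F_r b)) ⟩
        Tr 1 r (y * Tr r t b)       ≡⟨ cong (λ w → Tr 1 r (y * w)) Trb≡0 ⟩
        Tr 1 r (y * 0#)             ≡⟨ cong (Tr 1 r) (zeroʳ y) ⟩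
        Tr 1 r 0#                   ≡⟨ Tr-0# 1 r ⟩
        0#                          ∎

    -- y′ = y^(2^(m-r)) has y′^(2^r) = y, so Tr_1^m(b₀y) = Tr_1^m(z (y′ + y)) for b₀ = z^(2^r) + z,
    -- and y′ + y ≠ 0 because y ∉ F_{2^r}.
    sumB-balanced : ¬ InSub r y → sumB ≡ 0ℚ
    sumB-balanced y∉F_r = balanced (inverse δ δ≢0) (Tr₁-nondegenerate m |F_m|)
      where
      y′ δ : F
      y′ = y ^2^ (t′ ℕ.* r)
      δ = y′ + y
      y′∈F_m : InSub m y′
      y′∈F_m = InSub-^2^ {m} y∈F_m (t′ ℕ.* r)
      y′^2^r≡y : y′ ^2^ r ≡ y
      y′^2^r≡y = trans (^2^-^2^ y (t′ ℕ.* r) r) (trans (cong (y ^2^_) (ℕₚ.+-comm (t′ ℕ.* r) r)) y∈F_m)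
      δ≢0 : δ ≢ 0#
      δ≢0 δ≡0 = y∉F_r (trans (cong (_^2^ r) (sym (x+y≡0⇒x≡y δ≡0))) y′^2^r≡y)
      δ∈F_m : InSub m δ
      δ∈F_m = InSub-+ {m} y′∈F_m y∈F_m
      balanced : (∃ λ δ⁻¹ → δ * δ⁻¹ ≡ 1#) → (∃ λ w → InSub m w × Tr 1 m w ≢ 0#) → sumB ≡ 0ℚ
      balanced (δ⁻¹ , δδ⁻¹≡1) (w , w∈ , Trw≢0) = ∑-sgn-balanced (enumerate! B?) v (λ {b} _ → v-bit b) v-+
        (λ b∈ → ∈enumerate⁺ B? (B-+ (∈enumerate⁻ B? b∈) b₀∈B)) vb₀≡1
        where
        z b₀ : F
        z = w * δ⁻¹
        b₀ = z ^2^ r + z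
        z∈F_m : InSub m z
        z∈F_m = InSub-* {m} w∈ (InSub-⁻¹ {m} δ∈F_m δδ⁻¹≡1)
        b₀∈B : InSub m b₀ × Tr r t b₀ ≡ 0#
        b₀∈B = InSub-+ {m} (InSub-^2^ {m} z∈F_m r) z∈F_m ,
               trans (Tr-telescope r t z) (x≡y⇒x+y≡0 (subst (λ e → InSub e z) (ℕₚ.*-comm t r) z∈F_m))
        B-+ : ∀ {a b} → InSub m a × Tr r t a ≡ 0# → InSub m b × Tr r t b ≡ 0# →
              InSub m (a + b) × Tr r t (a + b) ≡ 0#
        B-+ {a} {b} (a∈ , Tra≡0) (b∈ , Trb≡0) =
          InSub-+ {m} a∈ b∈ , trans (Tr-+ r t a b) (trans (cong₂ _+_ Tra≡0 Trb≡0) (+-identityˡ 0#))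
        zδ≡w : z * δ ≡ w
        zδ≡w = trans (*-assoc w δ⁻¹ δ) (trans (cong (w *_) (trans (*-comm δ⁻¹ δ) δδ⁻¹≡1)) (*-identityʳ w))
        vb₀≡Trw : v b₀ ≡ Tr 1 m w
        vb₀≡Trw = begin
          v b₀                                        ≡⟨ v≡ (proj₁ b₀∈B) ⟩
          Tr 1 m (b₀ * y)                             ≡⟨ cong (Tr 1 m) (distribʳ y (z ^2^ r) z) ⟩
          Tr 1 m (z ^2^ r * y + z * y)                ≡⟨ Tr-+ 1 m _ _ ⟩
          Tr 1 m (z ^2^ r * y) + Tr 1 m (z * y)       ≡⟨ cong (λ q → Tr 1 m q + Tr 1 m (z * y))
                                                           (trans (cong (z ^2^ r *_) (sym y′^2^r≡y)) (sym (^2^-* z y′ r))) ⟩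
          Tr 1 m ((z * y′) ^2^ r) + Tr 1 m (z * y)    ≡⟨ cong (_+ Tr 1 m (z * y)) (Tr₁-^2^ m (InSub-* {m} z∈F_m y′∈F_m) r) ⟩
          Tr 1 m (z * y′) + Tr 1 m (z * y)            ≡⟨ sym (Tr-+ 1 m _ _) ⟩
          Tr 1 m (z * y′ + z * y)                     ≡⟨ cong (Tr 1 m) (sym (distribˡ z y′ y)) ⟩
          Tr 1 m (z * δ)                              ≡⟨ cong (Tr 1 m) zδ≡w ⟩
          Tr 1 m w                                    ∎
        vb₀≡1 : v b₀ ≡ 1#
        vb₀≡1 = IsBit-≢0 (v-bit b₀) λ vb₀≡0 → Trw≢0 (trans (sym vb₀≡Trw) vb₀≡0)

    double-sum≡product : vsum (sub-elems K r) (λ a → vsum (b-elems K t r) (λ b → B K m a b)) x ≡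
              (inv2^ m ℚ.* sumA) ℚ.* sumB
    double-sum≡product = begin
      vsum (sub-elems K r) (λ a → vsum (b-elems K t r) (λ b → B K m a b)) x
        ≡⟨ vsum-∑ (enumerate A?) _ x ⟩
      Σℚ.∑ (enumerate A?) (λ a → vsum (b-elems K t r) (λ b → B K m a b) x)
        ≡⟨ Σℚ.∑-congˡ (enumerate A?) (λ a → trans (vsum-∑ (b-elems K t r) _ x)
             (cong (λ L → Σℚ.∑ L (λ b → B K m a b x)) (filter-∩ (inSub? m) (λ b → Tr r t b ≟ 0#) elems))) ⟩
      Σℚ.∑ (enumerate A?) (λ a → Σℚ.∑ (enumerate B?) (λ b → inv2^ m ℚ.* sgn (u a + v b)))
        ≡⟨ Σℚ.∑-cong (enumerate A?) (λ a∈ → Σℚ.∑-congˡ (enumerate B?) (λ b →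
             cong (inv2^ m ℚ.*_) (sgn-+ (u-bit (∈enumerate⁻ A? a∈)) (v-bit b)))) ⟩
      Σℚ.∑ (enumerate A?) (λ a → Σℚ.∑ (enumerate B?) (λ b → inv2^ m ℚ.* (sgn (u a) ℚ.* sgn (v b))))
        ≡⟨ Σℚ.∑-*-∑ (enumerate A?) (enumerate B?) (inv2^ m) (sgn ∘ u) (sgn ∘ v) ⟩
      (inv2^ m ℚ.* sumA) ℚ.* sumB
        ∎

    product≡indicator : (inv2^ m ℚ.* sumA) ℚ.* sumB ≡ Σℚ.when (inS? K t r x) 1ℚ
    product≡indicator with c ≟ 0# | inSub? r y
    ... | yes c≡0 | yes y∈F_r = begin
      (inv2^ m ℚ.* sumA) ℚ.* sumB
        ≡⟨ cong₂ (λ p q → (inv2^ m ℚ.* p) ℚ.* q) (sumA-trivial c≡0) (sumB-trivial y∈F_r) ⟩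
      (inv2^ (r ℕ.+ t′ ℕ.* r) ℚ.* (2 ^ r) Σℚ.· 1ℚ) ℚ.* (2 ^ (t′ ℕ.* r)) Σℚ.· 1ℚ
        ≡⟨ inv2^-cancel-+ r (t′ ℕ.* r) ⟩
      1ℚ
        ∎
    ... | no c≢0 | _ = begin
      (inv2^ m ℚ.* sumA) ℚ.* sumB   ≡⟨ cong (λ p → (inv2^ m ℚ.* p) ℚ.* sumB) (sumA-balanced c≢0) ⟩
      (inv2^ m ℚ.* 0ℚ) ℚ.* sumB     ≡⟨ cong (ℚ._* sumB) (ℚₚ.*-zeroʳ (inv2^ m)) ⟩
      0ℚ ℚ.* sumB                   ≡⟨ ℚₚ.*-zeroˡ sumB ⟩
      0ℚ                            ∎
    ... | yes _ | no y∉F_r = begin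
      (inv2^ m ℚ.* sumA) ℚ.* sumB   ≡⟨ cong ((inv2^ m ℚ.* sumA) ℚ.*_) (sumB-balanced y∉F_r) ⟩
      (inv2^ m ℚ.* sumA) ℚ.* 0ℚ     ≡⟨ ℚₚ.*-zeroʳ (inv2^ m ℚ.* sumA) ⟩
      0ℚ                            ∎

    pointwise : vsub (vsum (sub-elems K r) (λ a → vsum (b-elems K t r) (λ b → B K m a b)))
                     (vsum (S-elems K t r) (e K)) x ≡ vzero x
    pointwise = trans (cong₂ (λ p q → p ℚ.+ ℚ.- q) (trans double-sum≡product product≡indicator)
                                                  (vsum-e (inS? K t r) x))
                      (ℚₚ.+-inverseʳ (Σℚ.when (inS? K t r x) 1ℚ))

open import Data.Nat using (_*_; _≤_)

lemma8 : (t r : ℕ) → 1 ≤ t → 1 ≤ r → (K : GF2^ (2 * (t * r))) →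
    ∀ x → vsub (vsum (sub-elems K r) (λ a → vsum (b-elems K t r) (λ b → B K (t * r) a b)))
               (vsum (S-elems K t r) (e K)) x
          ≡ vzero x
lemma8 (suc t′) (suc r′) _ _ K x = Setting.AtPoint.pointwise t′ (suc r′) K x
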